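{- Let $m$ be a positive integer, let $\Phi\subseteq\mathbf{2}^{[m]}$ be a DS-system with $\#\Phi>0$, and let $n$ be a positive integer with $\eta(\Phi)\le n$ and $n\equiv\mathrm{size}(\Phi)\pmod 2$. Let $(\mathsf{p}_{ij})$ be the profile of a partition of $\Phi$ into Boolean intervals. Then for every integer $0\le l\le n$: $\sum_{i,j}\mathsf{p}_{ij}(-1)^{i+j}\binom{j}{l-i}=(-1)^n\sum_{i,j}\mathsf{p}_{ij}\binom{i}{l-j}$; $\sum_{i,j}\mathsf{p}_{ij}(-1)^j\binom{n-i-j}{l-i}=(-1)^n\sum_{i,j}\mathsf{p}_{ij}(-1)^j\binom{n-i-j}{l-j}$; $\sum_s\binom{s}{l}\sum_{i,j}\mathsf{p}_{ij}(-1)^j\binom{n-i-j}{s-j}=(-1)^n\sum_s\binom{n-s}{l}\sum_{i,j}\mathsf{p}_{ij}(-1)^j\binom{n-i-j}{s-j}$.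
   Context: For a positive integer $k$, $[k]=\{1,\dots,k\}$; $\#$ denotes the number of sets in a family. For $\Phi$ a family of subsets of $[k]$ and $0\le i\le k$, $f_i(\Phi;k)=\#\{F\in\Phi:|F|=i\}$, and $h_0(\Phi;k),\dots,h_k(\Phi;k)$ are defined by $\sum_{i=0}^k h_i(\Phi;k)y^{k-i}=\sum_{i=0}^k f_i(\Phi;k)(y-1)^{k-i}$. If $\#\Phi>0$, $\mathrm{size}(\Phi)=\max_{F\in\Phi}|F|$. A face system $\Phi\subseteq\mathbf{2}^{[m]}$ is a DS-system if $h_l(\Phi;m)=(-1)^{m-\mathrm{size}(\Phi)}h_{m-l}(\Phi;m)$ for all $0\le l\le m$. For $\#\Phi>0$, with $u=|\bigcup_{F\in\Phi}F|$, $\eta(\Phi)=u$ if $u\equiv\mathrm{size}(\Phi)\pmod2$ and $\eta(\Phi)=u+1$ otherwise. For faces $A\subseteq C$, the Boolean interval is $[A,C]=\{B:A\subseteq B\subseteq C\}$. For a partition $\Phi=[A_1,B_1]\,\dot\cup\cdots\dot\cup\,[A_\theta,B_\theta]$ into disjoint Boolean intervals, its profile is $\mathsf{p}_{ij}=\#\{k:|B_k-A_k|=i,\ |A_k|=j\}$ (sums over $i,j$ run over all nonnegative integers with $\mathsf{p}_{ij}=0$ if no such interval exists; sums over $s$ run over $0,\dots,n$). Binomial coefficients $\binom{a}{b}$ with $a\ge0$ are $0$ when $b<0$ or $b>a$. -}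

module Defs where

open import Data.Nat as ℕ using (ℕ; zero; suc; _∸_; _⊔_)
open import Data.Nat.Combinatorics using (_C_)
open import Data.Integer as ℤ using (ℤ; +_; -[1+_]; 0ℤ; 1ℤ; -1ℤ; _^_)
open import Data.Bool using (Bool; true; false; if_then_else_)
open import Data.Fin using (Fin)
open import Data.Fin.Subset using (Subset; ∣_∣; ⋃; _⊆_; _─_) renaming (_∈_ to _∈ₛ_)
open import Data.List using (List; []; _∷_; length; map; foldr)
open import Data.List.Membership.Propositional using () renaming (_∈_ to _∈ₗ_)
open import Data.List.Relation.Unary.Unique.Propositional using (Unique)
open import Data.Product using (Σ; _×_; _,_; ∃)
open import Relation.Binary.PropositionalEquality using (_≡_; _≢_)
open import Relation.Nullary using (¬_)
open import Relation.Nullary.Decidable using (⌊_⌋)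
open import Function.Bundles using (_⇔_)

sumTo : ℕ → (ℕ → ℤ) → ℤ
sumTo zero    f = f 0
sumTo (suc n) f = sumTo n f ℤ.+ f (suc n)

sumFin : (θ : ℕ) → (Fin θ → ℕ) → ℕ
sumFin zero    f = 0
sumFin (suc θ) f = f Fin.zero ℕ.+ sumFin θ (λ k → f (Fin.suc k))
  where import Data.Fin as Fin

countFin : (θ : ℕ) → (Fin θ → Bool) → ℕ
countFin θ P = sumFin θ (λ k → if P k then 1 else 0)

sgn : ℕ → ℤ
sgn k = -1ℤ ^ k

-- binomial coefficient (a choose b) with a ≥ 0 and b an integer;
-- 0 when b < 0 or b > a (stdlib's _C_ is 0 when b > a)
binom : ℕ → ℤ → ℤ
binom a (+ b)      = + (a C b)
binom a -[1+ _ ]   = 0ℤ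

-- Polynomials in one variable y, as coefficient functions ℕ → ℤ
-- (coefficient of y^d).  All polynomials used below have finite support.

Poly : Set
Poly = ℕ → ℤ

pconst : ℤ → Poly
pconst c zero    = c
pconst c (suc _) = 0ℤ

yMinus1 : Poly
yMinus1 zero          = -1ℤ
yMinus1 (suc zero)    = 1ℤ
yMinus1 (suc (suc _)) = 0ℤ

_+ₚ_ : Poly → Poly → Poly
(p +ₚ q) d = p d ℤ.+ q d

_*ₚ_ : Poly → Poly → Poly
(p *ₚ q) d = sumTo d (λ a → p a ℤ.* q (d ∸ a))

_^ₚ_ : Poly → ℕ → Poly
p ^ₚ zero  = pconst 1ℤ
p ^ₚ suc e = p *ₚ (p ^ₚ e)

psumTo : ℕ → (ℕ → Poly) → Poly
psumTo zero    g = g 0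
psumTo (suc n) g = psumTo n g +ₚ g (suc n)

-- Face systems: a family Φ of subsets of [m], given as a duplicate-free list

FaceSystem : ℕ → Set
FaceSystem m = List (Subset m)

card : ∀ {m} → FaceSystem m → ℕ
card = length

fvec : ∀ {m} → FaceSystem m → ℕ → ℕ
fvec []       i = 0
fvec (F ∷ Φ)  i = (if ⌊ ∣ F ∣ ℕ.≟ i ⌋ then 1 else 0) ℕ.+ fvec Φ i

-- h_i(Φ;k): the coefficient of y^{k-i} in Σ_{j=0}^{k} f_j(Φ;k) (y-1)^{k-j},
-- i.e. the h_i determined by Σ_i h_i y^{k-i} = Σ_j f_j (y-1)^{k-j}.
hvec : ∀ {m} → FaceSystem m → (k : ℕ) → ℕ → ℤ
hvec Φ k i = psumTo k (λ j → pconst (+ fvec Φ j) *ₚ (yMinus1 ^ₚ (k ∸ j))) (k ∸ i)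

-- size(Φ) = max_{F∈Φ} |F|  (meaningful when #Φ > 0)
size : ∀ {m} → FaceSystem m → ℕ
size Φ = foldr (λ F r → ∣ F ∣ ⊔ r) 0 Φ

IsDS : ∀ {m} → FaceSystem m → Set
IsDS {m} Φ = ∀ l → l ℕ.≤ m → hvec Φ m l ≡ sgn (m ∸ size Φ) ℤ.* hvec Φ m (m ∸ l)

η : ∀ {m} → FaceSystem m → ℕ
η Φ = if ⌊ (∣ ⋃ Φ ∣ ℕ.% 2) ℕ.≟ (size Φ ℕ.% 2) ⌋ then ∣ ⋃ Φ ∣ else suc ∣ ⋃ Φ ∣

_∈[_,_] : ∀ {m} → Subset m → Subset m → Subset m → Set
F ∈[ A , C ] = (A ⊆ F) × (F ⊆ C)

record IntervalPartition {m} (Φ : FaceSystem m) : Set where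
  field
    θ        : ℕ
    lo hi    : Fin θ → Subset m
    lo⊆hi    : ∀ k → lo k ⊆ hi k
    cover    : ∀ F → (F ∈ₗ Φ) ⇔ (∃ λ k → F ∈[ lo k , hi k ])
    disjoint : ∀ k k′ → k ≢ k′ → ∀ F → ¬ (F ∈[ lo k , hi k ] × F ∈[ lo k′ , hi k′ ])

profile : ∀ {m} {Φ : FaceSystem m} → IntervalPartition Φ → ℕ → ℕ → ℕ
profile P i j = countFin θ (λ k → ⌊ ∣ hi k ─ lo k ∣ ℕ.≟ i ⌋ ∧ ⌊ ∣ lo k ∣ ℕ.≟ j ⌋)
  where open IntervalPartition P
        open import Data.Bool using (_∧_)

-- Σ_{i,j} p_{ij} g(i,j): since |B_k| ≤ m, p_{ij} = 0 unless i + j ≤ m,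
-- so the sum over all nonnegative i, j equals the sum over 0 ≤ i, j ≤ m.
psum : ∀ {m} {Φ : FaceSystem m} → IntervalPartition Φ → (ℕ → ℕ → ℤ) → ℤ
psum {m} P g = sumTo m (λ i → sumTo m (λ j → + profile P i j ℤ.* g i j))

-- Let F(a, b) = Σ_{F ∈ Φ} a^|F| b^(m - |F|) be the homogenised f-polynomial of Φ.  The
-- h-vector is the coefficient sequence of F(z, y - z), so the Dehn–Sommerville relations
-- say F(a, b) = (-1)^size(Φ) F(-(a + b), b).  Summing the monomials of each Boolean interval
-- [A, C] gives F(a, b) = Σ_k a^|A_k| (a + b)^|C_k - A_k| b^(m - |C_k|); re-homogenising this
-- interval form R to degree n ≥ η(Φ) ≥ |C_k| and using n ≡ size(Φ) (mod 2) turns the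
-- relation into R(-(a + b), b) = (-1)^n R(a, b).  The first identity compares coefficients
-- of the two sides of this; the second compares those of R(-a, a + b) and of its transpose,
-- and says that γ_s = Σ p_ij (-1)^j C(n - i - j, s - j) satisfies γ_(n-s) = (-1)^n γ_s,
-- from which the third follows by reversing the summation.  Coefficients of binary forms
-- are compared by evaluating at (x, 1) for all positive integers x.

module Submission where

open import Defs
open import Data.Nat using () renaming (_+_ to _ℕ+_)
open import Data.Nat using (ℕ; _≤_; _<_; _%_; _∸_; NonZero)
open import Data.Integer using (ℤ; +_; _-_; _*_)
open import Data.List.Relation.Unary.Unique.Propositional using (Unique)
open import Data.Product using (_×_)
open import Relation.Binary.PropositionalEquality using (_≡_)

open import Data.Bool using (if_then_else_; _∧_)
import Data.Bool.Properties as Bool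
open import Data.Empty using (⊥-elim)
open import Data.Fin as Fin using (Fin; punchIn)
open import Data.Fin.Properties using (punchInᵢ≢i)
open import Data.Fin.Subset using (Subset; inside; outside; _⊆_; _─_; ∣_∣; ⋃)
open import Data.Fin.Subset.Properties
  using (_⊆?_; drop-∷-⊆; ∣p∣≤n; p⊆q⇒∣p∣≤∣q∣; ⊆-trans; p⊆p∪q; q⊆p∪q)
open import Data.Integer using (_+_; -_; _^_; 0ℤ; 1ℤ; -1ℤ)
import Data.Integer as ℤ
import Data.Integer.Properties as ℤP
open import Algebra.Properties.AbelianGroup ℤP.+-0-abelianGroup using (inverseˡ-unique)
open import Algebra.Properties.Semiring.Sum ℤP.+-*-semiring
  using (sum; sum-syntax; ∑-distrib-+; *-distribˡ-sum; sum-cong-≗; sum-remove; sum-replicate-zero)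
open import Data.Integer.Tactic.RingSolver using (solve-∀)
open import Data.List using (List; []; _∷_)
open import Data.List.Membership.Propositional using () renaming (_∈_ to _∈ₗ_)
open import Data.List.Relation.Unary.All.Properties using (All¬⇒¬Any)
open import Data.List.Relation.Unary.AllPairs using (_∷_)
open import Data.List.Relation.Unary.Any using (here; there; any?)
open import Data.Nat using (zero; suc; z≤n; s≤s)
import Data.Nat as ℕ
open import Data.Nat.Combinatorics using (_C_; nCk+nC[k+1]≡[n+1]C[k+1])
open import Data.Nat.DivMod using (_/_; m≡m%n+[m/n]*n)
import Data.Nat.Properties as ℕP
open import Data.Product using (_,_; proj₁; proj₂)
open import Data.Sum using (inj₁; inj₂)
open import Data.Vec using ([]; _∷_) renaming (here to hereᵥ)
open import Data.Vec.Properties using (∷-injectiveʳ; ≡-dec)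
open import Function.Bundles using (Equivalence)
open import Relation.Binary.Definitions using (DecidableEquality)
open import Relation.Binary.PropositionalEquality
  using (_≢_; refl; sym; trans; cong; cong₂; subst; module ≡-Reasoning)
open import Relation.Nullary using (Dec; does; yes; no; ¬_; contradiction; _×-dec_)
open import Relation.Nullary.Decidable using (⌊_⌋; isYes≗does)

open ≡-Reasoning

-- Finite sums

sumTo-cong : ∀ n {f g : ℕ → ℤ} → (∀ i → i ≤ n → f i ≡ g i) → sumTo n f ≡ sumTo n g
sumTo-cong zero    f≡g = f≡g 0 z≤n
sumTo-cong (suc n) f≡g =
  cong₂ _+_ (sumTo-cong n (λ i i≤n → f≡g i (ℕP.m≤n⇒m≤1+n i≤n))) (f≡g (suc n) ℕP.≤-refl)

sumTo-distrib-+ : ∀ n (f g : ℕ → ℤ) → sumTo n (λ i → f i + g i) ≡ sumTo n f + sumTo n g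
sumTo-distrib-+ zero    f g = refl
sumTo-distrib-+ (suc n) f g = begin
  sumTo n (λ i → f i + g i) + (f (suc n) + g (suc n))
    ≡⟨ cong (_+ (f (suc n) + g (suc n))) (sumTo-distrib-+ n f g) ⟩
  sumTo n f + sumTo n g + (f (suc n) + g (suc n))
    ≡⟨ +-interchange (sumTo n f) (sumTo n g) (f (suc n)) (g (suc n)) ⟩
  sumTo n f + f (suc n) + (sumTo n g + g (suc n)) ∎
  where
  +-interchange : ∀ a b c d → a + b + (c + d) ≡ a + c + (b + d)
  +-interchange = solve-∀

*-distribˡ-sumTo : ∀ n c (f : ℕ → ℤ) → c * sumTo n f ≡ sumTo n (λ i → c * f i)
*-distribˡ-sumTo zero    c f = refl
*-distribˡ-sumTo (suc n) c f =
  trans (ℤP.*-distribˡ-+ c (sumTo n f) (f (suc n))) (cong (_+ c * f (suc n)) (*-distribˡ-sumTo n c f))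

sumTo-zero : ∀ n {f : ℕ → ℤ} → (∀ i → i ≤ n → f i ≡ 0ℤ) → sumTo n f ≡ 0ℤ
sumTo-zero zero    f≡0 = f≡0 0 z≤n
sumTo-zero (suc n) f≡0 =
  cong₂ _+_ (sumTo-zero n (λ i i≤n → f≡0 i (ℕP.m≤n⇒m≤1+n i≤n))) (f≡0 (suc n) ℕP.≤-refl)

sumTo-single : ∀ n {x} {f : ℕ → ℤ} → x ≤ n → (∀ i → i ≢ x → f i ≡ 0ℤ) → sumTo n f ≡ f x
sumTo-single zero    z≤n     _   = refl
sumTo-single (suc n) {x} {f} x≤1+n off with ℕP.m≤n⇒m<n∨m≡n x≤1+n
... | inj₁ (s≤s x≤n) = begin
  sumTo n f + f (suc n) ≡⟨ cong₂ _+_ (sumTo-single n x≤n off) (off (suc n) (ℕP.>⇒≢ (s≤s x≤n))) ⟩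
  f x + 0ℤ              ≡⟨ ℤP.+-identityʳ (f x) ⟩
  f x                   ∎
... | inj₂ refl = begin
  sumTo n f + f (suc n) ≡⟨ cong (_+ f (suc n)) (sumTo-zero n (λ i i≤n → off i (ℕP.<⇒≢ (s≤s i≤n)))) ⟩
  0ℤ + f (suc n)        ≡⟨ ℤP.+-identityˡ (f (suc n)) ⟩
  f (suc n)             ∎

sumTo-unfoldˡ : ∀ n (f : ℕ → ℤ) → sumTo (suc n) f ≡ f 0 + sumTo n (λ i → f (suc i))
sumTo-unfoldˡ zero    f = refl
sumTo-unfoldˡ (suc n) f =
  trans (cong (_+ f (suc (suc n))) (sumTo-unfoldˡ n f)) (ℤP.+-assoc (f 0) _ _)

sumTo-reverse : ∀ n (f : ℕ → ℤ) → sumTo n (λ i → f (n ∸ i)) ≡ sumTo n f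
sumTo-reverse zero    f = refl
sumTo-reverse (suc n) f = begin
  sumTo (suc n) (λ i → f (suc n ∸ i))  ≡⟨ sumTo-unfoldˡ n (λ i → f (suc n ∸ i)) ⟩
  f (suc n) + sumTo n (λ i → f (n ∸ i)) ≡⟨ cong (_+_ (f (suc n))) (sumTo-reverse n f) ⟩
  f (suc n) + sumTo n f                 ≡⟨ ℤP.+-comm (f (suc n)) (sumTo n f) ⟩
  sumTo (suc n) f                       ∎

sumTo-comm : ∀ n m (h : ℕ → ℕ → ℤ) →
             sumTo n (λ i → sumTo m (h i)) ≡ sumTo m (λ j → sumTo n (λ i → h i j))
sumTo-comm zero    m h = refl
sumTo-comm (suc n) m h = trans (cong (_+ sumTo m (h (suc n))) (sumTo-comm n m h))
  (sym (sumTo-distrib-+ m (λ j → sumTo n (λ i → h i j)) (h (suc n))))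

sumTo-∑ : ∀ n {θ} (h : ℕ → Fin θ → ℤ) →
          sumTo n (λ i → ∑[ k < θ ] h i k) ≡ ∑[ k < θ ] sumTo n (λ i → h i k)
sumTo-∑ zero    h = refl
sumTo-∑ (suc n) h = trans (cong (_+ ∑[ k < _ ] h (suc n) k) (sumTo-∑ n h))
  (sym (∑-distrib-+ (λ k → sumTo n (λ i → h i k)) (h (suc n))))

-- Defined through `does` rather than ⌊_⌋ so that it computes on _×-dec_ and _⊆?_.
χ : ∀ {p} {P : Set p} → Dec P → ℤ
χ d = + (if does d then 1 else 0)

χ-yes : ∀ {p} {P : Set p} (d : Dec P) → P → χ d ≡ 1ℤ
χ-yes (yes _)  _ = refl
χ-yes (no ¬p)  p = contradiction p ¬p

χ-no : ∀ {p} {P : Set p} (d : Dec P) → ¬ P → χ d ≡ 0ℤ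
χ-no (yes p) ¬p = contradiction p ¬p
χ-no (no _)  _  = refl

χ-⌊⌋ : ∀ {p} {P : Set p} (d : Dec P) → + (if ⌊ d ⌋ then 1 else 0) ≡ χ d
χ-⌊⌋ d = cong (λ b → + (if b then 1 else 0)) (isYes≗does d)

∑-zero : ∀ {θ} {f : Fin θ → ℤ} → (∀ k → f k ≡ 0ℤ) → ∑[ k < θ ] f k ≡ 0ℤ
∑-zero {θ} f≡0 = trans (sum-cong-≗ f≡0) (sum-replicate-zero θ)

∑-single : ∀ {θ} {f : Fin θ → ℤ} k → (∀ k′ → k′ ≢ k → f k′ ≡ 0ℤ) → ∑[ k′ < θ ] f k′ ≡ f k
∑-single {suc θ} {f} k off = begin
  sum f                                 ≡⟨ sum-remove {i = k} f ⟩
  f k + ∑[ k′ < θ ] f (punchIn k k′)    ≡⟨ cong (_+_ (f k)) (∑-zero (λ k′ → off _ (punchInᵢ≢i k k′))) ⟩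
  f k + 0ℤ                              ≡⟨ ℤP.+-identityʳ (f k) ⟩
  f k                                   ∎

sgn-+ : ∀ a b → sgn (a ℕ+ b) ≡ sgn a * sgn b
sgn-+ = ℤP.^-distribˡ-+-* -1ℤ

sgn-*-sgn : ∀ k → sgn k * sgn k ≡ 1ℤ
sgn-*-sgn zero    = refl
sgn-*-sgn (suc k) = trans (square-neg (sgn k)) (sgn-*-sgn k)
  where
  square-neg : ∀ x → (-1ℤ * x) * (-1ℤ * x) ≡ x * x
  square-neg = solve-∀

neg-^ : ∀ x k → (- x) ^ k ≡ sgn k * x ^ k
neg-^ x zero    = refl
neg-^ x (suc k) = trans (cong (- x *_) (neg-^ x k)) (pull-sign x (sgn k) (x ^ k))
  where
  pull-sign : ∀ x s y → - x * (s * y) ≡ -1ℤ * s * (x * y)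
  pull-sign = solve-∀

sgn-%2 : ∀ k → sgn k ≡ sgn (k % 2)
sgn-%2 k = begin
  sgn k                                  ≡⟨ cong sgn (m≡m%n+[m/n]*n k 2) ⟩
  sgn (k % 2 ℕ+ k / 2 ℕ.* 2)             ≡⟨ sgn-+ (k % 2) (k / 2 ℕ.* 2) ⟩
  sgn (k % 2) * sgn (k / 2 ℕ.* 2)        ≡⟨ cong (_*_ (sgn (k % 2))) (sgn-even (k / 2)) ⟩
  sgn (k % 2) * 1ℤ                       ≡⟨ ℤP.*-identityʳ (sgn (k % 2)) ⟩
  sgn (k % 2)                            ∎
  where
  sgn-even : ∀ q → sgn (q ℕ.* 2) ≡ 1ℤ
  sgn-even q = trans (cong sgn (ℕP.*-comm q 2)) (trans (sym (ℤP.^-*-assoc -1ℤ 2 q)) (ℤP.^-zeroˡ q))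

sgn-cong-%2 : ∀ a b → a % 2 ≡ b % 2 → sgn a ≡ sgn b
sgn-cong-%2 a b eq = trans (sgn-%2 a) (trans (cong sgn eq) (sym (sgn-%2 b)))

-- Binary forms

form : ℕ → (ℕ → ℤ) → ℤ → ℤ → ℤ
form N c a b = sumTo N (λ s → c s * (a ^ s * b ^ (N ∸ s)))

form-cong : ∀ N {c d : ℕ → ℤ} → (∀ s → s ≤ N → c s ≡ d s) → ∀ a b → form N c a b ≡ form N d a b
form-cong N c≡d a b = sumTo-cong N (λ s s≤N → cong (_* (a ^ s * b ^ (N ∸ s))) (c≡d s s≤N))

form-distrib-+ : ∀ N (c d : ℕ → ℤ) a b → form N (λ s → c s + d s) a b ≡ form N c a b + form N d a b
form-distrib-+ N c d a b = trans
  (sumTo-cong N (λ s _ → ℤP.*-distribʳ-+ (a ^ s * b ^ (N ∸ s)) (c s) (d s)))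
  (sumTo-distrib-+ N _ _)

*-distribˡ-form : ∀ N x (c : ℕ → ℤ) a b → x * form N c a b ≡ form N (λ s → x * c s) a b
*-distribˡ-form N x c a b = trans (*-distribˡ-sumTo N x _)
  (sumTo-cong N (λ s _ → sym (ℤP.*-assoc x (c s) (a ^ s * b ^ (N ∸ s)))))

form-sumTo : ∀ N M (w : ℕ → ℕ → ℤ) a b →
             form N (λ s → sumTo M (λ j → w j s)) a b ≡ sumTo M (λ j → form N (w j) a b)
form-sumTo N M w a b = begin
  sumTo N (λ s → sumTo M (λ j → w j s) * μ s)
    ≡⟨ sumTo-cong N (λ s _ → trans (ℤP.*-comm _ (μ s)) (*-distribˡ-sumTo M (μ s) (λ j → w j s))) ⟩
  sumTo N (λ s → sumTo M (λ j → μ s * w j s))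
    ≡⟨ sumTo-comm N M (λ s j → μ s * w j s) ⟩
  sumTo M (λ j → sumTo N (λ s → μ s * w j s))
    ≡⟨ sumTo-cong M (λ j _ → sumTo-cong N (λ s _ → ℤP.*-comm (μ s) (w j s))) ⟩
  sumTo M (λ j → form N (w j) a b) ∎
  where
  μ : ℕ → ℤ
  μ s = a ^ s * b ^ (N ∸ s)

form-∑ : ∀ N {θ} (w : Fin θ → ℕ → ℤ) a b →
         form N (λ s → ∑[ k < θ ] w k s) a b ≡ ∑[ k < θ ] form N (w k) a b
form-∑ N {θ} w a b = begin
  sumTo N (λ s → ∑[ k < θ ] w k s * μ s)
    ≡⟨ sumTo-cong N (λ s _ → trans (ℤP.*-comm _ (μ s)) (*-distribˡ-sum (μ s) (λ k → w k s))) ⟩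
  sumTo N (λ s → ∑[ k < θ ] (μ s * w k s))
    ≡⟨ sumTo-∑ N (λ s k → μ s * w k s) ⟩
  ∑[ k < θ ] sumTo N (λ s → μ s * w k s)
    ≡⟨ sum-cong-≗ (λ k → sumTo-cong N (λ s _ → ℤP.*-comm (μ s) (w k s))) ⟩
  ∑[ k < θ ] form N (w k) a b ∎
  where
  μ : ℕ → ℤ
  μ s = a ^ s * b ^ (N ∸ s)

form-unfoldˡ : ∀ N c a b → form (suc N) c a b ≡ c 0 * b ^ suc N + a * form N (λ s → c (suc s)) a b
form-unfoldˡ N c a b = trans (sumTo-unfoldˡ N _) (cong₂ _+_
  (cong (c 0 *_) (ℤP.*-identityˡ (b ^ suc N)))
  (trans (sumTo-cong N (λ s _ → shuffle (c (suc s)) a (a ^ s) (b ^ (N ∸ s)))) (sym (*-distribˡ-sumTo N a _))))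
  where
  shuffle : ∀ x y z w → x * (y * z * w) ≡ y * (x * (z * w))
  shuffle = solve-∀

form-unfoldʳ : ∀ N c a b → form (suc N) c a b ≡ b * form N c a b + c (suc N) * a ^ suc N
form-unfoldʳ N c a b = cong₂ _+_
  (trans (sumTo-cong N (λ s s≤N → trans (cong (λ e → c s * (a ^ s * b ^ e)) (ℕP.+-∸-assoc 1 s≤N))
                                       (shuffle (c s) (a ^ s) b (b ^ (N ∸ s)))))
         (sym (*-distribˡ-sumTo N b _)))
  (trans (cong (λ e → c (suc N) * (a ^ suc N * b ^ e)) (ℕP.n∸n≡0 N))
         (cong (c (suc N) *_) (ℤP.*-identityʳ (a ^ suc N))))
  where
  shuffle : ∀ x y z w → x * (y * (z * w)) ≡ z * (x * (y * w))
  shuffle = solve-∀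

form-reverse : ∀ N c a b → form N (λ s → c (N ∸ s)) a b ≡ form N c b a
form-reverse N c a b = trans (sumTo-cong N swap-powers) (sumTo-reverse N (λ s → c s * (b ^ s * a ^ (N ∸ s))))
  where
  swap-powers : ∀ s → s ≤ N → c (N ∸ s) * (a ^ s * b ^ (N ∸ s))
                              ≡ c (N ∸ s) * (b ^ (N ∸ s) * a ^ (N ∸ (N ∸ s)))
  swap-powers s s≤N = cong (c (N ∸ s) *_) (trans (ℤP.*-comm (a ^ s) (b ^ (N ∸ s)))
    (cong (λ e → b ^ (N ∸ s) * a ^ e) (sym (ℕP.m∸[m∸n]≡n s≤N))))

form-neg : ∀ N c a b → form N c (- a) (- b) ≡ sgn N * form N c a b
form-neg N c a b = trans (sumTo-cong N signs) (sym (*-distribˡ-sumTo N (sgn N) _))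
  where
  shuffle : ∀ x s t y z → x * (s * y * (t * z)) ≡ s * t * (x * (y * z))
  shuffle = solve-∀
  signs : ∀ s → s ≤ N → c s * ((- a) ^ s * (- b) ^ (N ∸ s)) ≡ sgn N * (c s * (a ^ s * b ^ (N ∸ s)))
  signs s s≤N = begin
    c s * ((- a) ^ s * (- b) ^ (N ∸ s))
      ≡⟨ cong₂ (λ u v → c s * (u * v)) (neg-^ a s) (neg-^ b (N ∸ s)) ⟩
    c s * (sgn s * a ^ s * (sgn (N ∸ s) * b ^ (N ∸ s)))
      ≡⟨ shuffle (c s) (sgn s) (sgn (N ∸ s)) (a ^ s) (b ^ (N ∸ s)) ⟩
    sgn s * sgn (N ∸ s) * (c s * (a ^ s * b ^ (N ∸ s)))
      ≡⟨ cong (_* (c s * (a ^ s * b ^ (N ∸ s)))) (trans (sym (sgn-+ s (N ∸ s))) (cong sgn (ℕP.m+[n∸m]≡n s≤N))) ⟩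
    sgn N * (c s * (a ^ s * b ^ (N ∸ s))) ∎

form-single : ∀ N {x} → x ≤ N → ∀ a b → form N (λ s → χ (x ℕ.≟ s)) a b ≡ a ^ x * b ^ (N ∸ x)
form-single N {x} x≤N a b = begin
  form N (λ s → χ (x ℕ.≟ s)) a b            ≡⟨ sumTo-single N x≤N off ⟩
  χ (x ℕ.≟ x) * (a ^ x * b ^ (N ∸ x))       ≡⟨ cong (_* (a ^ x * b ^ (N ∸ x))) (χ-yes (x ℕ.≟ x) refl) ⟩
  1ℤ * (a ^ x * b ^ (N ∸ x))                ≡⟨ ℤP.*-identityˡ _ ⟩
  a ^ x * b ^ (N ∸ x)                       ∎
  where
  off : ∀ s → s ≢ x → χ (x ℕ.≟ s) * (a ^ s * b ^ (N ∸ s)) ≡ 0ℤ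
  off s s≢x = cong (_* (a ^ s * b ^ (N ∸ s))) (χ-no (x ℕ.≟ s) (λ x≡s → s≢x (sym x≡s)))

module Pascal (α β : ℤ) (u : ℕ → ℕ → ℤ)
  (u-0-0 : u 0 0 ≡ 1ℤ) (u-0-suc : ∀ s → u 0 (suc s) ≡ 0ℤ)
  (u-suc-0 : ∀ e → u (suc e) 0 ≡ β * u e 0)
  (u-suc-suc : ∀ e s → u (suc e) (suc s) ≡ α * u e s + β * u e (suc s)) where

  u-vanishes : ∀ e s → e < s → u e s ≡ 0ℤ
  u-vanishes zero    (suc s) _         = u-0-suc s
  u-vanishes (suc e) (suc s) (s≤s e<s) = begin
    u (suc e) (suc s)             ≡⟨ u-suc-suc e s ⟩
    α * u e s + β * u e (suc s)   ≡⟨ cong₂ (λ x y → α * x + β * y) (u-vanishes e s e<s) (u-vanishes e (suc s) (ℕP.m<n⇒m<1+n e<s)) ⟩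
    α * 0ℤ + β * 0ℤ               ≡⟨ cong₂ _+_ (ℤP.*-zeroʳ α) (ℤP.*-zeroʳ β) ⟩
    0ℤ                            ∎

  form-row-0 : ∀ N a b → form N (u 0) a b ≡ b ^ N
  form-row-0 zero    a b = cong (_* 1ℤ) u-0-0
  form-row-0 (suc N) a b = begin
    form (suc N) (u 0) a b
      ≡⟨ form-unfoldˡ N (u 0) a b ⟩
    u 0 0 * b ^ suc N + a * form N (λ s → u 0 (suc s)) a b
      ≡⟨ cong₂ (λ x y → x * b ^ suc N + a * y) u-0-0 (sumTo-zero N (λ s _ → cong (_* _) (u-0-suc s))) ⟩
    1ℤ * b ^ suc N + a * 0ℤ
      ≡⟨ cleanup (b ^ suc N) a ⟩
    b ^ suc N ∎
    where
    cleanup : ∀ x y → 1ℤ * x + y * 0ℤ ≡ x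
    cleanup = solve-∀

  form-row : ∀ e N → e ≤ N → ∀ a b → form N (u e) a b ≡ (α * a + β * b) ^ e * b ^ (N ∸ e)
  form-row zero    N       _         a b = trans (form-row-0 N a b) (sym (ℤP.*-identityˡ (b ^ N)))
  form-row (suc e) (suc N) (s≤s e≤N) a b = begin
    form (suc N) (u (suc e)) a b
      ≡⟨ form-cong (suc N) recurrence a b ⟩
    form (suc N) (λ s → α * shifted s + β * u e s) a b
      ≡⟨ form-distrib-+ (suc N) (λ s → α * shifted s) (λ s → β * u e s) a b ⟩
    form (suc N) (λ s → α * shifted s) a b + form (suc N) (λ s → β * u e s) a b
      ≡⟨ cong₂ _+_ (sym (*-distribˡ-form (suc N) α shifted a b)) (sym (*-distribˡ-form (suc N) β (u e) a b)) ⟩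
    α * form (suc N) shifted a b + β * form (suc N) (u e) a b
      ≡⟨ cong₂ (λ x y → α * x + β * y) (form-unfoldˡ N shifted a b) (form-unfoldʳ N (u e) a b) ⟩
    α * (0ℤ * b ^ suc N + a * X) + β * (b * X + u e (suc N) * a ^ suc N)
      ≡⟨ cong (λ z → α * (0ℤ * b ^ suc N + a * X) + β * (b * X + z * a ^ suc N)) (u-vanishes e (suc N) (s≤s e≤N)) ⟩
    α * (0ℤ * b ^ suc N + a * X) + β * (b * X + 0ℤ * a ^ suc N)
      ≡⟨ collect α β a b X (b ^ suc N) (a ^ suc N) ⟩
    (α * a + β * b) * X
      ≡⟨ cong ((α * a + β * b) *_) (form-row e N e≤N a b) ⟩
    (α * a + β * b) * ((α * a + β * b) ^ e * b ^ (N ∸ e))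
      ≡⟨ sym (ℤP.*-assoc (α * a + β * b) _ _) ⟩
    (α * a + β * b) ^ suc e * b ^ (N ∸ e) ∎
    where
    X : ℤ
    X = form N (u e) a b
    shifted : ℕ → ℤ
    shifted zero    = 0ℤ
    shifted (suc s) = u e s
    recurrence : ∀ s → s ≤ suc N → u (suc e) s ≡ α * shifted s + β * u e s
    recurrence zero    _ = trans (u-suc-0 e)
      (sym (trans (cong (_+ β * u e 0) (ℤP.*-zeroʳ α)) (ℤP.+-identityˡ (β * u e 0))))
    recurrence (suc s) _ = u-suc-suc e s
    collect : ∀ α β a b X y z → α * (0ℤ * y + a * X) + β * (b * X + 0ℤ * z) ≡ (α * a + β * b) * X
    collect = solve-∀

form-binomial : ∀ e N → e ≤ N → ∀ a b → form N (λ s → + (e C s)) a b ≡ (a + b) ^ e * b ^ (N ∸ e)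
form-binomial e N e≤N a b = trans
  (Pascal.form-row 1ℤ 1ℤ (λ e s → + (e C s)) refl (λ _ → refl) (λ _ → refl) pascal-rule e N e≤N a b)
  (cong (λ x → x ^ e * b ^ (N ∸ e)) (cong₂ _+_ (ℤP.*-identityˡ a) (ℤP.*-identityˡ b)))
  where
  pascal-rule : ∀ e s → + (suc e C suc s) ≡ 1ℤ * + (e C s) + 1ℤ * + (e C suc s)
  pascal-rule e s = begin
    + (suc e C suc s)                  ≡⟨ cong +_ (sym (nCk+nC[k+1]≡[n+1]C[k+1] e s)) ⟩
    + (e C s ℕ+ e C suc s)             ≡⟨ ℤP.pos-+ (e C s) (e C suc s) ⟩
    + (e C s) + + (e C suc s)          ≡⟨ sym (cong₂ _+_ (ℤP.*-identityˡ (+ (e C s))) (ℤP.*-identityˡ (+ (e C suc s)))) ⟩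
    1ℤ * + (e C s) + 1ℤ * + (e C suc s) ∎

form-binomial-shift : ∀ {N} j e r → j ℕ+ e ℕ+ r ≡ N → ∀ a b →
  form N (λ s → binom e (+ s - + j)) a b ≡ a ^ j * (a + b) ^ e * b ^ r
form-binomial-shift zero e r refl a b = begin
  form (e ℕ+ r) (λ s → binom e (+ s - 0ℤ)) a b
    ≡⟨ form-cong (e ℕ+ r) (λ s _ → cong (binom e) (ℤP.+-identityʳ (+ s))) a b ⟩
  form (e ℕ+ r) (λ s → + (e C s)) a b
    ≡⟨ form-binomial e (e ℕ+ r) (ℕP.m≤m+n e r) a b ⟩
  (a + b) ^ e * b ^ (e ℕ+ r ∸ e)
    ≡⟨ cong₂ _*_ (sym (ℤP.*-identityˡ ((a + b) ^ e))) (cong (b ^_) (ℕP.m+n∸m≡n e r)) ⟩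
  1ℤ * (a + b) ^ e * b ^ r ∎
form-binomial-shift (suc j) e r refl a b = begin
  form (suc N) (λ s → binom e (+ s - + suc j)) a b
    ≡⟨ form-unfoldˡ N (λ s → binom e (+ s - + suc j)) a b ⟩
  0ℤ * b ^ suc N + a * form N (λ s → binom e (+ suc s - + suc j)) a b
    ≡⟨ cong (λ z → 0ℤ * b ^ suc N + a * z) (form-cong N (λ s _ → cong (binom e) (suc-cancel (+ s) (+ j))) a b) ⟩
  0ℤ * b ^ suc N + a * form N (λ s → binom e (+ s - + j)) a b
    ≡⟨ cong (λ z → 0ℤ * b ^ suc N + a * z) (form-binomial-shift j e r refl a b) ⟩
  0ℤ * b ^ suc N + a * (a ^ j * (a + b) ^ e * b ^ r)
    ≡⟨ cleanup (b ^ suc N) a (a ^ j) ((a + b) ^ e) (b ^ r) ⟩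
  a * a ^ j * (a + b) ^ e * b ^ r ∎
  where
  N : ℕ
  N = j ℕ+ e ℕ+ r
  suc-cancel : ∀ x y → (1ℤ + x) - (1ℤ + y) ≡ x - y
  suc-cancel = solve-∀
  cleanup : ∀ w a x y z → 0ℤ * w + a * (x * y * z) ≡ a * x * y * z
  cleanup = solve-∀

form-yMinus1^ : ∀ e N → e ≤ N → ∀ a b → form N (yMinus1 ^ₚ e) a b ≡ (a - b) ^ e * b ^ (N ∸ e)
form-yMinus1^ e N e≤N a b = trans
  (Pascal.form-row 1ℤ -1ℤ (λ e → yMinus1 ^ₚ e) refl (λ _ → refl) (λ _ → refl) pascal-rule e N e≤N a b)
  (cong (λ x → x ^ e * b ^ (N ∸ e)) (tidy a b))
  where
  tidy : ∀ a b → 1ℤ * a + -1ℤ * b ≡ a - b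
  tidy = solve-∀
  yMinus1-* : ∀ s (p : Poly) → sumTo (suc s) (λ i → yMinus1 i * p i) ≡ -1ℤ * p 0 + 1ℤ * p 1
  yMinus1-* zero    p = refl
  yMinus1-* (suc s) p = trans (cong (_+ 0ℤ * p (suc (suc s))) (yMinus1-* s p))
    (trans (cong (_+_ (-1ℤ * p 0 + 1ℤ * p 1)) (ℤP.*-zeroˡ (p (suc (suc s))))) (ℤP.+-identityʳ _))
  pascal-rule : ∀ e s → (yMinus1 ^ₚ suc e) (suc s) ≡ 1ℤ * (yMinus1 ^ₚ e) s + -1ℤ * (yMinus1 ^ₚ e) (suc s)
  pascal-rule e s = trans (yMinus1-* s (λ i → (yMinus1 ^ₚ e) (suc s ∸ i)))
    (ℤP.+-comm (-1ℤ * (yMinus1 ^ₚ e) (suc s)) (1ℤ * (yMinus1 ^ₚ e) s))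

n≡[1+n]*k⇒n≡0 : ∀ n k → n ≡ suc n ℕ.* k → n ≡ 0
n≡[1+n]*k⇒n≡0 n zero    eq = trans eq (ℕP.*-zeroʳ n)
n≡[1+n]*k⇒n≡0 n (suc k) eq =
  contradiction (ℕP.≤-trans (ℕP.m≤m*n (suc n) (suc k)) (ℕP.≤-reflexive (sym eq))) ℕP.1+n≰n

form-vanishing : ∀ N (c : ℕ → ℤ) → (∀ t → form N c (+ suc t) 1ℤ ≡ 0ℤ) → ∀ s → s ≤ N → c s ≡ 0ℤ
form-vanishing zero    c vanish zero    z≤n       = trans (sym (ℤP.*-identityʳ (c 0))) (vanish 0)
form-vanishing (suc N) c vanish zero    _         = ℤP.∣i∣≡0⇒i≡0 (n≡[1+n]*k⇒n≡0 T ℤ.∣ rest T ∣ (begin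
  ℤ.∣ c 0 ∣                   ≡⟨ cong ℤ.∣_∣ (inverseˡ-unique (c 0) (+ suc T * rest T) (split T)) ⟩
  ℤ.∣ - (+ suc T * rest T) ∣  ≡⟨ ℤP.∣-i∣≡∣i∣ (+ suc T * rest T) ⟩
  ℤ.∣ + suc T * rest T ∣      ≡⟨ ℤP.abs-* (+ suc T) (rest T) ⟩
  suc T ℕ.* ℤ.∣ rest T ∣      ∎))
  where
  -- evaluating at T + 1 with T = |c 0| forces |c 0| to be a multiple of |c 0| + 1
  T : ℕ
  T = ℤ.∣ c 0 ∣
  rest : ℕ → ℤ
  rest t = form N (λ s → c (suc s)) (+ suc t) 1ℤ
  split : ∀ t → c 0 + + suc t * rest t ≡ 0ℤ
  split t = begin
    c 0 + + suc t * rest t                ≡⟨ cong (_+ + suc t * rest t) (sym (ℤP.*-identityʳ (c 0))) ⟩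
    c 0 * 1ℤ + + suc t * rest t           ≡⟨ cong (λ z → c 0 * z + + suc t * rest t) (sym (ℤP.^-zeroˡ (suc N))) ⟩
    c 0 * 1ℤ ^ suc N + + suc t * rest t   ≡⟨ sym (form-unfoldˡ N c (+ suc t) 1ℤ) ⟩
    form (suc N) c (+ suc t) 1ℤ           ≡⟨ vanish t ⟩
    0ℤ                                    ∎
form-vanishing (suc N) c vanish (suc s) (s≤s s≤N) =
  form-vanishing N (λ s → c (suc s)) vanish-rest s s≤N
  where
  c0≡0 : c 0 ≡ 0ℤ
  c0≡0 = form-vanishing (suc N) c vanish zero z≤n
  vanish-rest : ∀ t → form N (λ s → c (suc s)) (+ suc t) 1ℤ ≡ 0ℤ
  vanish-rest t = ℤP.*-cancelˡ-≡ (+ suc t) _ 0ℤ (begin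
    + suc t * form N (λ s → c (suc s)) (+ suc t) 1ℤ
      ≡⟨ sym (ℤP.+-identityˡ _) ⟩
    0ℤ * 1ℤ ^ suc N + + suc t * form N (λ s → c (suc s)) (+ suc t) 1ℤ
      ≡⟨ cong (λ z → z * 1ℤ ^ suc N + + suc t * form N (λ s → c (suc s)) (+ suc t) 1ℤ) (sym c0≡0) ⟩
    c 0 * 1ℤ ^ suc N + + suc t * form N (λ s → c (suc s)) (+ suc t) 1ℤ
      ≡⟨ sym (form-unfoldˡ N c (+ suc t) 1ℤ) ⟩
    form (suc N) c (+ suc t) 1ℤ
      ≡⟨ vanish t ⟩
    0ℤ
      ≡⟨ sym (ℤP.*-zeroʳ (+ suc t)) ⟩
    + suc t * 0ℤ ∎)

form-injective : ∀ N (c d : ℕ → ℤ) → (∀ t → form N c (+ suc t) 1ℤ ≡ form N d (+ suc t) 1ℤ) →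
                 ∀ s → s ≤ N → c s ≡ d s
form-injective N c d agree s s≤N =
  ℤP.i-j≡0⇒i≡j (c s) (d s) (form-vanishing N (λ s → c s - d s) difference s s≤N)
  where
  difference : ∀ t → form N (λ s → c s - d s) (+ suc t) 1ℤ ≡ 0ℤ
  difference t = begin
    form N (λ s → c s - d s) x 1ℤ                ≡⟨ form-distrib-+ N c (λ s → - d s) x 1ℤ ⟩
    form N c x 1ℤ + form N (λ s → - d s) x 1ℤ    ≡⟨ cong (_+_ (form N c x 1ℤ)) (form-cong N (λ s _ → sym (ℤP.-1*i≡-i (d s))) x 1ℤ) ⟩
    form N c x 1ℤ + form N (λ s → -1ℤ * d s) x 1ℤ ≡⟨ cong (_+_ (form N c x 1ℤ)) (sym (*-distribˡ-form N -1ℤ d x 1ℤ)) ⟩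
    form N c x 1ℤ + -1ℤ * form N d x 1ℤ          ≡⟨ cong₂ (λ u v → u + v) (agree t) (ℤP.-1*i≡-i (form N d x 1ℤ)) ⟩
    form N d x 1ℤ - form N d x 1ℤ                ≡⟨ ℤP.+-inverseʳ (form N d x 1ℤ) ⟩
    0ℤ                                           ∎
    where
    x : ℤ
    x = + suc t

-- Sums over all subsets of [m]

∑ₛ : (m : ℕ) → (Subset m → ℤ) → ℤ
∑ₛ zero    w = w []
∑ₛ (suc m) w = ∑ₛ m (λ G → w (inside ∷ G)) + ∑ₛ m (λ G → w (outside ∷ G))

∑ₛ-cong : ∀ m {v w : Subset m → ℤ} → (∀ G → v G ≡ w G) → ∑ₛ m v ≡ ∑ₛ m w
∑ₛ-cong zero    v≡w = v≡w []
∑ₛ-cong (suc m) v≡w =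
  cong₂ _+_ (∑ₛ-cong m (λ G → v≡w (inside ∷ G))) (∑ₛ-cong m (λ G → v≡w (outside ∷ G)))

∑ₛ-zero : ∀ m {w : Subset m → ℤ} → (∀ G → w G ≡ 0ℤ) → ∑ₛ m w ≡ 0ℤ
∑ₛ-zero zero    w≡0 = w≡0 []
∑ₛ-zero (suc m) w≡0 =
  cong₂ _+_ (∑ₛ-zero m (λ G → w≡0 (inside ∷ G))) (∑ₛ-zero m (λ G → w≡0 (outside ∷ G)))

∑ₛ-distrib-+ : ∀ m (v w : Subset m → ℤ) → ∑ₛ m (λ G → v G + w G) ≡ ∑ₛ m v + ∑ₛ m w
∑ₛ-distrib-+ zero    v w = refl
∑ₛ-distrib-+ (suc m) v w = trans
  (cong₂ _+_ (∑ₛ-distrib-+ m (λ G → v (inside ∷ G)) (λ G → w (inside ∷ G)))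
             (∑ₛ-distrib-+ m (λ G → v (outside ∷ G)) (λ G → w (outside ∷ G))))
  (+-interchange (∑ₛ m (λ G → v (inside ∷ G))) (∑ₛ m (λ G → w (inside ∷ G)))
                 (∑ₛ m (λ G → v (outside ∷ G))) (∑ₛ m (λ G → w (outside ∷ G))))
  where
  +-interchange : ∀ a b c d → a + b + (c + d) ≡ a + c + (b + d)
  +-interchange = solve-∀

*-distribˡ-∑ₛ : ∀ m x (w : Subset m → ℤ) → x * ∑ₛ m w ≡ ∑ₛ m (λ G → x * w G)
*-distribˡ-∑ₛ zero    x w = refl
*-distribˡ-∑ₛ (suc m) x w = trans (ℤP.*-distribˡ-+ x _ _)
  (cong₂ _+_ (*-distribˡ-∑ₛ m x (λ G → w (inside ∷ G))) (*-distribˡ-∑ₛ m x (λ G → w (outside ∷ G))))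

∑ₛ-single : ∀ {m} F {w : Subset m → ℤ} → (∀ G → G ≢ F → w G ≡ 0ℤ) → ∑ₛ m w ≡ w F
∑ₛ-single []                  off = refl
∑ₛ-single {suc m} (inside ∷ F)  off = trans
  (cong₂ _+_ (∑ₛ-single F (λ G G≢F → off (inside ∷ G) (λ eq → G≢F (∷-injectiveʳ eq))))
             (∑ₛ-zero m (λ G → off (outside ∷ G) (λ ()))))
  (ℤP.+-identityʳ _)
∑ₛ-single {suc m} (outside ∷ F) off = trans
  (cong₂ _+_ (∑ₛ-zero m (λ G → off (inside ∷ G) (λ ())))
             (∑ₛ-single F (λ G G≢F → off (outside ∷ G) (λ eq → G≢F (∷-injectiveʳ eq)))))
  (ℤP.+-identityˡ _)

∑ₛ-∑ : ∀ m {θ} (w : Fin θ → Subset m → ℤ) → ∑ₛ m (λ G → ∑[ k < θ ] w k G) ≡ ∑[ k < θ ] ∑ₛ m (w k)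
∑ₛ-∑ zero    w = refl
∑ₛ-∑ (suc m) w = trans
  (cong₂ _+_ (∑ₛ-∑ m (λ k G → w k (inside ∷ G))) (∑ₛ-∑ m (λ k G → w k (outside ∷ G))))
  (sym (∑-distrib-+ (λ k → ∑ₛ m (λ G → w k (inside ∷ G))) (λ k → ∑ₛ m (λ G → w k (outside ∷ G)))))

weight : ∀ {m} → ℤ → ℤ → Subset m → ℤ
weight a b []            = 1ℤ
weight a b (inside ∷ G)  = a * weight a b G
weight a b (outside ∷ G) = b * weight a b G

^-suc∸∣∣ : ∀ {m} b (G : Subset m) → b ^ (suc m ∸ ∣ G ∣) ≡ b * b ^ (m ∸ ∣ G ∣)
^-suc∸∣∣ b G = cong (b ^_) (ℕP.+-∸-assoc 1 (∣p∣≤n G))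

weight-closed : ∀ {m} a b (G : Subset m) → weight a b G ≡ a ^ ∣ G ∣ * b ^ (m ∸ ∣ G ∣)
weight-closed a b []            = refl
weight-closed a b (inside ∷ G)  =
  trans (cong (a *_) (weight-closed a b G)) (sym (ℤP.*-assoc a (a ^ ∣ G ∣) _))
weight-closed a b (outside ∷ G) = begin
  b * weight a b G                        ≡⟨ cong (b *_) (weight-closed a b G) ⟩
  b * (a ^ ∣ G ∣ * b ^ (_ ∸ ∣ G ∣))       ≡⟨ ℤP.*-comm b _ ⟩
  a ^ ∣ G ∣ * b ^ (_ ∸ ∣ G ∣) * b         ≡⟨ ℤP.*-assoc (a ^ ∣ G ∣) _ b ⟩
  a ^ ∣ G ∣ * (b ^ (_ ∸ ∣ G ∣) * b)       ≡⟨ cong (a ^ ∣ G ∣ *_) (trans (ℤP.*-comm _ b) (sym (^-suc∸∣∣ b G))) ⟩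
  a ^ ∣ G ∣ * b ^ (suc _ ∸ ∣ G ∣)         ∎

inside⊈outside : ∀ {m} {p q : Subset m} → ¬ (inside ∷ p ⊆ outside ∷ q)
inside⊈outside p⊆q with p⊆q hereᵥ
... | ()

∣─∣+∣∣ : ∀ {m} {A B : Subset m} → A ⊆ B → ∣ B ─ A ∣ ℕ+ ∣ A ∣ ≡ ∣ B ∣
∣─∣+∣∣ {A = []}          {[]}          _   = refl
∣─∣+∣∣ {A = inside ∷ A}  {outside ∷ B} A⊆B = ⊥-elim (inside⊈outside A⊆B)
∣─∣+∣∣ {A = inside ∷ A}  {inside ∷ B}  A⊆B = trans (ℕP.+-suc _ _) (cong suc (∣─∣+∣∣ (drop-∷-⊆ A⊆B)))
∣─∣+∣∣ {A = outside ∷ A} {inside ∷ B}  A⊆B = cong suc (∣─∣+∣∣ (drop-∷-⊆ A⊆B))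
∣─∣+∣∣ {A = outside ∷ A} {outside ∷ B} A⊆B = ∣─∣+∣∣ (drop-∷-⊆ A⊆B)

∑ₛ-pull : ∀ m x (v w : Subset m → ℤ) → ∑ₛ m (λ G → v G * (x * w G)) ≡ x * ∑ₛ m (λ G → v G * w G)
∑ₛ-pull m x v w = trans (∑ₛ-cong m (λ G → swap-factor (v G) x (w G))) (sym (*-distribˡ-∑ₛ m x _))
  where
  swap-factor : ∀ u x w → u * (x * w) ≡ x * (u * w)
  swap-factor = solve-∀

infix 4 _∈[_,_]?
_∈[_,_]? : ∀ {m} (G A B : Subset m) → Dec (G ∈[ A , B ])
G ∈[ A , B ]? = A ⊆? G ×-dec G ⊆? B

∑ₛ-interval : ∀ {m} a b (A B : Subset m) → A ⊆ B →
  ∑ₛ m (λ G → χ (G ∈[ A , B ]?) * weight a b G) ≡ a ^ ∣ A ∣ * (a + b) ^ ∣ B ─ A ∣ * b ^ (m ∸ ∣ B ∣)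
∑ₛ-interval a b []            []            _   = refl
∑ₛ-interval a b (inside ∷ A)  (outside ∷ B) A⊆B = ⊥-elim (inside⊈outside A⊆B)
∑ₛ-interval {suc m} a b (inside ∷ A) (inside ∷ B) A⊆B = begin
  ∑ₛ m (λ G → χ (G ∈[ A , B ]?) * (a * weight a b G))
    + ∑ₛ m (λ G → χ (outside ∷ G ∈[ inside ∷ A , inside ∷ B ]?) * (b * weight a b G))
    ≡⟨ cong₂ _+_ (∑ₛ-pull m a (λ G → χ (G ∈[ A , B ]?)) (weight a b)) (∑ₛ-zero m (λ G → ℤP.*-zeroˡ (b * weight a b G))) ⟩
  a * ∑ₛ m (λ G → χ (G ∈[ A , B ]?) * weight a b G) + 0ℤ
    ≡⟨ cong (λ z → a * z + 0ℤ) (∑ₛ-interval a b A B (drop-∷-⊆ A⊆B)) ⟩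
  a * (a ^ ∣ A ∣ * (a + b) ^ ∣ B ─ A ∣ * b ^ (m ∸ ∣ B ∣)) + 0ℤ
    ≡⟨ tidy a (a ^ ∣ A ∣) ((a + b) ^ ∣ B ─ A ∣) (b ^ (m ∸ ∣ B ∣)) ⟩
  a * a ^ ∣ A ∣ * (a + b) ^ ∣ B ─ A ∣ * b ^ (m ∸ ∣ B ∣) ∎
  where
  tidy : ∀ a x y z → a * (x * y * z) + 0ℤ ≡ a * x * y * z
  tidy = solve-∀
∑ₛ-interval {suc m} a b (outside ∷ A) (inside ∷ B) A⊆B = begin
  ∑ₛ m (λ G → χ (G ∈[ A , B ]?) * (a * weight a b G)) + ∑ₛ m (λ G → χ (G ∈[ A , B ]?) * (b * weight a b G))
    ≡⟨ cong₂ _+_ (∑ₛ-pull m a (λ G → χ (G ∈[ A , B ]?)) (weight a b))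
                 (∑ₛ-pull m b (λ G → χ (G ∈[ A , B ]?)) (weight a b)) ⟩
  a * ∑ₛ m (λ G → χ (G ∈[ A , B ]?) * weight a b G) + b * ∑ₛ m (λ G → χ (G ∈[ A , B ]?) * weight a b G)
    ≡⟨ cong (λ z → a * z + b * z) (∑ₛ-interval a b A B (drop-∷-⊆ A⊆B)) ⟩
  a * (a ^ ∣ A ∣ * (a + b) ^ ∣ B ─ A ∣ * b ^ (m ∸ ∣ B ∣))
    + b * (a ^ ∣ A ∣ * (a + b) ^ ∣ B ─ A ∣ * b ^ (m ∸ ∣ B ∣))
    ≡⟨ collect a b (a ^ ∣ A ∣) ((a + b) ^ ∣ B ─ A ∣) (b ^ (m ∸ ∣ B ∣)) ⟩
  a ^ ∣ A ∣ * ((a + b) * (a + b) ^ ∣ B ─ A ∣) * b ^ (m ∸ ∣ B ∣) ∎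
  where
  collect : ∀ a b x y z → a * (x * y * z) + b * (x * y * z) ≡ x * ((a + b) * y) * z
  collect = solve-∀
∑ₛ-interval {suc m} a b (outside ∷ A) (outside ∷ B) A⊆B = begin
  ∑ₛ m (λ G → χ (inside ∷ G ∈[ outside ∷ A , outside ∷ B ]?) * (a * weight a b G))
    + ∑ₛ m (λ G → χ (G ∈[ A , B ]?) * (b * weight a b G))
    ≡⟨ cong₂ _+_ (∑ₛ-zero m (λ G → cong (_* (a * weight a b G)) (χ-no (inside ∷ G ∈[ outside ∷ A , outside ∷ B ]?)
                                                                     (λ G∈I → inside⊈outside (proj₂ G∈I)))))
                 (∑ₛ-pull m b (λ G → χ (G ∈[ A , B ]?)) (weight a b)) ⟩
  0ℤ + b * ∑ₛ m (λ G → χ (G ∈[ A , B ]?) * weight a b G)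
    ≡⟨ cong (λ z → 0ℤ + b * z) (∑ₛ-interval a b A B (drop-∷-⊆ A⊆B)) ⟩
  0ℤ + b * (a ^ ∣ A ∣ * (a + b) ^ ∣ B ─ A ∣ * b ^ (m ∸ ∣ B ∣))
    ≡⟨ tidy b (a ^ ∣ A ∣) ((a + b) ^ ∣ B ─ A ∣) (b ^ (m ∸ ∣ B ∣)) ⟩
  a ^ ∣ A ∣ * (a + b) ^ ∣ B ─ A ∣ * (b * b ^ (m ∸ ∣ B ∣))
    ≡⟨ cong (a ^ ∣ A ∣ * (a + b) ^ ∣ B ─ A ∣ *_) (sym (^-suc∸∣∣ b B)) ⟩
  a ^ ∣ A ∣ * (a + b) ^ ∣ B ─ A ∣ * b ^ (suc m ∸ ∣ B ∣) ∎
  where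
  tidy : ∀ b x y z → 0ℤ + b * (x * y * z) ≡ x * y * (b * z)
  tidy = solve-∀

_≟ₛ_ : ∀ {m} → DecidableEquality (Subset m)
_≟ₛ_ = ≡-dec Bool._≟_

infix 4 _∈ₗ?_
_∈ₗ?_ : ∀ {m} (G : Subset m) (Φ : List (Subset m)) → Dec (G ∈ₗ Φ)
G ∈ₗ? Φ = any? (G ≟ₛ_) Φ

χ-∈-∷ : ∀ {m} (G F : Subset m) {Φ} → ¬ (F ∈ₗ Φ) → χ (G ∈ₗ? F ∷ Φ) ≡ χ (G ≟ₛ F) + χ (G ∈ₗ? Φ)
χ-∈-∷ G F {Φ} F∉Φ with G ≟ₛ F
... | yes refl = cong (_+_ 1ℤ) (sym (χ-no (G ∈ₗ? Φ) F∉Φ))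
... | no _     = sym (ℤP.+-identityˡ (χ (G ∈ₗ? Φ)))

∑ₗ : ∀ {a} {A : Set a} → List A → (A → ℤ) → ℤ
∑ₗ []       w = 0ℤ
∑ₗ (x ∷ xs) w = w x + ∑ₗ xs w

∑ₗ-as-∑ₛ : ∀ {m} (Φ : List (Subset m)) → Unique Φ → ∀ w → ∑ₗ Φ w ≡ ∑ₛ m (λ G → χ (G ∈ₗ? Φ) * w G)
∑ₗ-as-∑ₛ {m} []      _              w = sym (∑ₛ-zero m (λ G → ℤP.*-zeroˡ (w G)))
∑ₗ-as-∑ₛ {m} (F ∷ Φ) (F∉Φ ∷ Φ-uniq) w = begin
  w F + ∑ₗ Φ w
    ≡⟨ cong₂ _+_ (sym single) (∑ₗ-as-∑ₛ Φ Φ-uniq w) ⟩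
  ∑ₛ m (λ G → χ (G ≟ₛ F) * w G) + ∑ₛ m (λ G → χ (G ∈ₗ? Φ) * w G)
    ≡⟨ sym (∑ₛ-distrib-+ m (λ G → χ (G ≟ₛ F) * w G) (λ G → χ (G ∈ₗ? Φ) * w G)) ⟩
  ∑ₛ m (λ G → χ (G ≟ₛ F) * w G + χ (G ∈ₗ? Φ) * w G)
    ≡⟨ ∑ₛ-cong m (λ G → trans (sym (ℤP.*-distribʳ-+ (w G) (χ (G ≟ₛ F)) (χ (G ∈ₗ? Φ))))
                              (cong (_* w G) (sym (χ-∈-∷ G F (All¬⇒¬Any F∉Φ))))) ⟩
  ∑ₛ m (λ G → χ (G ∈ₗ? F ∷ Φ) * w G) ∎
  where
  single : ∑ₛ m (λ G → χ (G ≟ₛ F) * w G) ≡ w F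
  single = begin
    ∑ₛ m (λ G → χ (G ≟ₛ F) * w G) ≡⟨ ∑ₛ-single F (λ G G≢F → cong (_* w G) (χ-no (G ≟ₛ F) G≢F)) ⟩
    χ (F ≟ₛ F) * w F              ≡⟨ cong (_* w F) (χ-yes (F ≟ₛ F) refl) ⟩
    1ℤ * w F                      ≡⟨ ℤP.*-identityˡ (w F) ⟩
    w F                           ∎

-- Face systems and the Dehn–Sommerville relations

form-fvec : ∀ {m} (Φ : FaceSystem m) a b → form m (λ l → + fvec Φ l) a b ≡ ∑ₗ Φ (weight a b)
form-fvec {m} []      a b = sumTo-zero m (λ s _ → ℤP.*-zeroˡ (a ^ s * b ^ (m ∸ s)))
form-fvec {m} (F ∷ Φ) a b = begin
  form m (λ l → + fvec (F ∷ Φ) l) a b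
    ≡⟨ form-cong m (λ l _ → trans (ℤP.pos-+ (if ⌊ ∣ F ∣ ℕ.≟ l ⌋ then 1 else 0) (fvec Φ l))
                                  (cong (_+ + fvec Φ l) (χ-⌊⌋ (∣ F ∣ ℕ.≟ l)))) a b ⟩
  form m (λ l → χ (∣ F ∣ ℕ.≟ l) + + fvec Φ l) a b
    ≡⟨ form-distrib-+ m (λ l → χ (∣ F ∣ ℕ.≟ l)) (λ l → + fvec Φ l) a b ⟩
  form m (λ l → χ (∣ F ∣ ℕ.≟ l)) a b + form m (λ l → + fvec Φ l) a b
    ≡⟨ cong₂ _+_ (trans (form-single m (∣p∣≤n F) a b) (sym (weight-closed a b F))) (form-fvec Φ a b) ⟩
  weight a b F + ∑ₗ Φ (weight a b) ∎

pconst-*ₚ : ∀ c (p : Poly) d → (pconst c *ₚ p) d ≡ c * p d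
pconst-*ₚ c p d = sumTo-single d z≤n off
  where
  off : ∀ i → i ≢ 0 → pconst c i * p (d ∸ i) ≡ 0ℤ
  off zero    i≢0 = ⊥-elim (i≢0 refl)
  off (suc i) _   = ℤP.*-zeroˡ (p (d ∸ suc i))

psumTo-apply : ∀ k (g : ℕ → Poly) d → psumTo k g d ≡ sumTo k (λ j → g j d)
psumTo-apply zero    g d = refl
psumTo-apply (suc k) g d = cong (_+ g (suc k) d) (psumTo-apply k g d)

hvec-as-sumTo : ∀ {m} (Φ : FaceSystem m) k i →
                hvec Φ k i ≡ sumTo k (λ j → + fvec Φ j * (yMinus1 ^ₚ (k ∸ j)) (k ∸ i))
hvec-as-sumTo Φ k i = trans (psumTo-apply k _ (k ∸ i))
  (sumTo-cong k (λ j _ → pconst-*ₚ (+ fvec Φ j) (yMinus1 ^ₚ (k ∸ j)) (k ∸ i)))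

form-hvec : ∀ {m} (Φ : FaceSystem m) y z →
            form m (λ d → hvec Φ m (m ∸ d)) y z ≡ form m (λ l → + fvec Φ l) z (y - z)
form-hvec {m} Φ y z = begin
  form m (λ d → hvec Φ m (m ∸ d)) y z
    ≡⟨ form-cong m (λ d d≤m → trans (hvec-as-sumTo Φ m (m ∸ d))
         (sumTo-cong m (λ j _ → cong (λ e → f j * (yMinus1 ^ₚ (m ∸ j)) e) (ℕP.m∸[m∸n]≡n d≤m)))) y z ⟩
  form m (λ d → sumTo m (λ j → f j * (yMinus1 ^ₚ (m ∸ j)) d)) y z
    ≡⟨ form-sumTo m m (λ j d → f j * (yMinus1 ^ₚ (m ∸ j)) d) y z ⟩
  sumTo m (λ j → form m (λ d → f j * (yMinus1 ^ₚ (m ∸ j)) d) y z)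
    ≡⟨ sumTo-cong m (λ j _ → sym (*-distribˡ-form m (f j) (yMinus1 ^ₚ (m ∸ j)) y z)) ⟩
  sumTo m (λ j → f j * form m (yMinus1 ^ₚ (m ∸ j)) y z)
    ≡⟨ sumTo-cong m (λ j j≤m → cong (f j *_) (begin
         form m (yMinus1 ^ₚ (m ∸ j)) y z                 ≡⟨ form-yMinus1^ (m ∸ j) m (ℕP.m∸n≤m m j) y z ⟩
         (y - z) ^ (m ∸ j) * z ^ (m ∸ (m ∸ j))           ≡⟨ cong (λ e → (y - z) ^ (m ∸ j) * z ^ e) (ℕP.m∸[m∸n]≡n j≤m) ⟩
         (y - z) ^ (m ∸ j) * z ^ j                       ≡⟨ ℤP.*-comm ((y - z) ^ (m ∸ j)) (z ^ j) ⟩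
         z ^ j * (y - z) ^ (m ∸ j)                       ∎)) ⟩
  form m f z (y - z) ∎
  where
  f : ℕ → ℤ
  f l = + fvec Φ l

size≤ : ∀ {m} (Φ : FaceSystem m) → size Φ ≤ m
size≤ []      = z≤n
size≤ (F ∷ Φ) = ℕP.⊔-lub (∣p∣≤n F) (size≤ Φ)

form-hvec-DS : ∀ {m} (Φ : FaceSystem m) → IsDS Φ → ∀ y z →
               form m (λ d → hvec Φ m (m ∸ d)) y z ≡ sgn (m ∸ size Φ) * form m (λ d → hvec Φ m (m ∸ d)) z y
form-hvec-DS {m} Φ ds y z = begin
  form m (λ d → hvec Φ m (m ∸ d)) y z
    ≡⟨ form-cong m (λ d d≤m → trans (ds (m ∸ d) (ℕP.m∸n≤m m d))
                                    (cong (λ e → ε * hvec Φ m e) (ℕP.m∸[m∸n]≡n d≤m))) y z ⟩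
  form m (λ d → ε * hvec Φ m d) y z
    ≡⟨ sym (*-distribˡ-form m ε (hvec Φ m) y z) ⟩
  ε * form m (hvec Φ m) y z
    ≡⟨ cong (ε *_) (form-cong m (λ d d≤m → cong (hvec Φ m) (sym (ℕP.m∸[m∸n]≡n d≤m))) y z) ⟩
  ε * form m (λ d → hvec Φ m (m ∸ (m ∸ d))) y z
    ≡⟨ cong (ε *_) (form-reverse m (λ d → hvec Φ m (m ∸ d)) y z) ⟩
  ε * form m (λ d → hvec Φ m (m ∸ d)) z y ∎
  where
  ε : ℤ
  ε = sgn (m ∸ size Φ)

form-fvec-reflect : ∀ {m} (Φ : FaceSystem m) → IsDS Φ → ∀ a b →
  form m (λ l → + fvec Φ l) a b ≡ sgn (size Φ) * form m (λ l → + fvec Φ l) (- (a + b)) b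
form-fvec-reflect {m} Φ ds a b = begin
  F a b                        ≡⟨ cong (F a) (sym (cancel₁ a b)) ⟩
  F a (a + b - a)              ≡⟨ sym (form-hvec Φ (a + b) a) ⟩
  H (a + b) a                  ≡⟨ form-hvec-DS Φ ds (a + b) a ⟩
  ε * H a (a + b)              ≡⟨ cong (ε *_) (form-hvec Φ a (a + b)) ⟩
  ε * F (a + b) (a - (a + b))  ≡⟨ cong₂ (λ u v → ε * F u v) (sym (ℤP.neg-involutive (a + b))) (cancel₂ a b) ⟩
  ε * F (- - (a + b)) (- b)    ≡⟨ cong (ε *_) (form-neg m f (- (a + b)) b) ⟩
  ε * (sgn m * F (- (a + b)) b) ≡⟨ sym (ℤP.*-assoc ε (sgn m) _) ⟩
  ε * sgn m * F (- (a + b)) b  ≡⟨ cong (_* F (- (a + b)) b) ε*sgn-m ⟩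
  sgn (size Φ) * F (- (a + b)) b ∎
  where
  f : ℕ → ℤ
  f l = + fvec Φ l
  F H : ℤ → ℤ → ℤ
  F = form m f
  H = form m (λ d → hvec Φ m (m ∸ d))
  ε : ℤ
  ε = sgn (m ∸ size Φ)
  cancel₁ : ∀ a b → a + b - a ≡ b
  cancel₁ = solve-∀
  cancel₂ : ∀ a b → a - (a + b) ≡ - b
  cancel₂ = solve-∀
  ε*sgn-m : ε * sgn m ≡ sgn (size Φ)
  ε*sgn-m = begin
    ε * sgn m                              ≡⟨ cong (λ e → ε * sgn e) (sym (ℕP.m+[n∸m]≡n (size≤ Φ))) ⟩
    ε * sgn (size Φ ℕ+ (m ∸ size Φ))       ≡⟨ cong (ε *_) (sgn-+ (size Φ) (m ∸ size Φ)) ⟩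
    ε * (sgn (size Φ) * ε)                 ≡⟨ ℤP.*-comm ε _ ⟩
    sgn (size Φ) * ε * ε                   ≡⟨ ℤP.*-assoc (sgn (size Φ)) ε ε ⟩
    sgn (size Φ) * (ε * ε)                 ≡⟨ cong (sgn (size Φ) *_) (sgn-*-sgn (m ∸ size Φ)) ⟩
    sgn (size Φ) * 1ℤ                      ≡⟨ ℤP.*-identityʳ (sgn (size Φ)) ⟩
    sgn (size Φ)                           ∎

-- Interval partitions

sumFin-∑ : ∀ θ (f : Fin θ → ℕ) y → + sumFin θ f * y ≡ ∑[ k < θ ] (+ f k * y)
sumFin-∑ zero    f y = ℤP.*-zeroˡ y
sumFin-∑ (suc θ) f y = begin
  + (f Fin.zero ℕ+ sumFin θ (λ k → f (Fin.suc k))) * y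
    ≡⟨ cong (_* y) (ℤP.pos-+ (f Fin.zero) (sumFin θ (λ k → f (Fin.suc k)))) ⟩
  (+ f Fin.zero + + sumFin θ (λ k → f (Fin.suc k))) * y
    ≡⟨ ℤP.*-distribʳ-+ y (+ f Fin.zero) (+ sumFin θ (λ k → f (Fin.suc k))) ⟩
  + f Fin.zero * y + + sumFin θ (λ k → f (Fin.suc k)) * y
    ≡⟨ cong (_+_ (+ f Fin.zero * y)) (sumFin-∑ θ (λ k → f (Fin.suc k)) y) ⟩
  ∑[ k < suc θ ] (+ f k * y) ∎

^-+-∸-comm : ∀ b {u} M N → u ≤ M → u ≤ N → b ^ M * b ^ (N ∸ u) ≡ b ^ N * b ^ (M ∸ u)
^-+-∸-comm b {u} M N u≤M u≤N = begin
  b ^ M * b ^ (N ∸ u)    ≡⟨ sym (ℤP.^-distribˡ-+-* b M (N ∸ u)) ⟩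
  b ^ (M ℕ+ (N ∸ u))     ≡⟨ cong (b ^_) (sym (ℕP.+-∸-assoc M u≤N)) ⟩
  b ^ (M ℕ+ N ∸ u)       ≡⟨ cong (λ e → b ^ (e ∸ u)) (ℕP.+-comm M N) ⟩
  b ^ (N ℕ+ M ∸ u)       ≡⟨ cong (b ^_) (ℕP.+-∸-assoc N u≤M) ⟩
  b ^ (N ℕ+ (M ∸ u))     ≡⟨ ℤP.^-distribˡ-+-* b N (M ∸ u) ⟩
  b ^ N * b ^ (M ∸ u)    ∎

∈⇒⊆⋃ : ∀ {m} {F : Subset m} {Φ : FaceSystem m} → F ∈ₗ Φ → F ⊆ ⋃ Φ
∈⇒⊆⋃ {Φ = G ∷ Φ} (here refl) = p⊆p∪q (⋃ Φ)
∈⇒⊆⋃ {Φ = G ∷ Φ} (there F∈Φ) = ⊆-trans (∈⇒⊆⋃ F∈Φ) (q⊆p∪q G (⋃ Φ))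

∣⋃∣≤η : ∀ {m} (Φ : FaceSystem m) → ∣ ⋃ Φ ∣ ≤ η Φ
∣⋃∣≤η Φ with (∣ ⋃ Φ ∣ ℕ.% 2) ℕ.≟ (size Φ ℕ.% 2)
... | yes _ = ℕP.≤-refl
... | no _  = ℕP.n≤1+n ∣ ⋃ Φ ∣

module _ {m} {Φ : FaceSystem m} (P : IntervalPartition Φ) where
  open IntervalPartition P

  span base : Fin θ → ℕ
  span k = ∣ hi k ─ lo k ∣
  base k = ∣ lo k ∣

  span+base≡∣hi∣ : ∀ k → span k ℕ+ base k ≡ ∣ hi k ∣
  span+base≡∣hi∣ k = ∣─∣+∣∣ (lo⊆hi k)

  span+base≤m : ∀ k → span k ℕ+ base k ≤ m
  span+base≤m k = subst (_≤ m) (sym (span+base≡∣hi∣ k)) (∣p∣≤n (hi k))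

  span+base≤η : ∀ k → span k ℕ+ base k ≤ η Φ
  span+base≤η k = subst (_≤ η Φ) (sym (span+base≡∣hi∣ k))
    (ℕP.≤-trans (p⊆q⇒∣p∣≤∣q∣ (∈⇒⊆⋃ hi∈Φ)) (∣⋃∣≤η Φ))
    where
    hi∈Φ : hi k ∈ₗ Φ
    hi∈Φ = Equivalence.from (cover (hi k)) (k , lo⊆hi k , (λ x∈hi → x∈hi))

  psum-as-∑ : ∀ g → psum P g ≡ ∑[ k < θ ] g (span k) (base k)
  psum-as-∑ g = begin
    sumTo m (λ i → sumTo m (λ j → + profile P i j * g i j))
      ≡⟨ sumTo-cong m (λ i _ → sumTo-cong m (λ j _ → trans (sumFin-∑ θ _ (g i j))
           (sum-cong-≗ (λ k → cong (λ b → + (if b then 1 else 0) * g i j)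
                                   (∧-isYes (span k ℕ.≟ i) (base k ℕ.≟ j)))))) ⟩
    sumTo m (λ i → sumTo m (λ j → ∑[ k < θ ] (χ (at k i j) * g i j)))
      ≡⟨ sumTo-cong m (λ i _ → sumTo-∑ m (λ j k → χ (at k i j) * g i j)) ⟩
    sumTo m (λ i → ∑[ k < θ ] sumTo m (λ j → χ (at k i j) * g i j))
      ≡⟨ sumTo-∑ m (λ i k → sumTo m (λ j → χ (at k i j) * g i j)) ⟩
    ∑[ k < θ ] sumTo m (λ i → sumTo m (λ j → χ (at k i j) * g i j))
      ≡⟨ sum-cong-≗ pick ⟩
    ∑[ k < θ ] g (span k) (base k) ∎
    where
    at : (k : Fin θ) (i j : ℕ) → Dec (span k ≡ i × base k ≡ j)
    at k i j = span k ℕ.≟ i ×-dec base k ℕ.≟ j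
    ∧-isYes : ∀ {A B : Set} (a : Dec A) (b : Dec B) → ⌊ a ⌋ ∧ ⌊ b ⌋ ≡ does (a ×-dec b)
    ∧-isYes a b = cong₂ _∧_ (isYes≗does a) (isYes≗does b)
    pick : ∀ k → sumTo m (λ i → sumTo m (λ j → χ (at k i j) * g i j)) ≡ g (span k) (base k)
    pick k = begin
      sumTo m (λ i → sumTo m (λ j → χ (at k i j) * g i j))
        ≡⟨ sumTo-single m (ℕP.m+n≤o⇒m≤o (span k) (span+base≤m k))
             (λ i i≢span → sumTo-zero m (λ j _ → cong (_* g i j) (χ-no (at k i j) (λ (span≡i , _) → i≢span (sym span≡i))))) ⟩
      sumTo m (λ j → χ (at k (span k) j) * g (span k) j)
        ≡⟨ sumTo-single m (ℕP.m+n≤o⇒n≤o (span k) (span+base≤m k))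
             (λ j j≢base → cong (_* g (span k) j) (χ-no (at k (span k) j) (λ (_ , base≡j) → j≢base (sym base≡j)))) ⟩
      χ (at k (span k) (base k)) * g (span k) (base k)
        ≡⟨ cong (_* g (span k) (base k)) (χ-yes (at k (span k) (base k)) (refl , refl)) ⟩
      1ℤ * g (span k) (base k)
        ≡⟨ ℤP.*-identityˡ (g (span k) (base k)) ⟩
      g (span k) (base k) ∎

  form-psum : ∀ N (g : ℕ → ℕ → ℕ → ℤ) a b →
    form N (λ l → psum P (g l)) a b ≡ ∑[ k < θ ] form N (λ l → g l (span k) (base k)) a b
  form-psum N g a b = trans (form-cong N (λ l _ → psum-as-∑ (g l)) a b)
                            (form-∑ N (λ k l → g l (span k) (base k)) a b)

  χ-∈-as-∑ : ∀ G → χ (G ∈ₗ? Φ) ≡ ∑[ k < θ ] χ (G ∈[ lo k , hi k ]?)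
  χ-∈-as-∑ G with G ∈ₗ? Φ
  ... | yes G∈Φ = sym (trans (∑-single k off) (χ-yes (G ∈[ lo k , hi k ]?) G∈Iₖ))
    where
    k  = proj₁ (Equivalence.to (cover G) G∈Φ)
    G∈Iₖ = proj₂ (Equivalence.to (cover G) G∈Φ)
    off : ∀ k′ → k′ ≢ k → χ (G ∈[ lo k′ , hi k′ ]?) ≡ 0ℤ
    off k′ k′≢k = χ-no (G ∈[ lo k′ , hi k′ ]?) (λ G∈Iₖ′ → disjoint k′ k k′≢k G (G∈Iₖ′ , G∈Iₖ))
  ... | no G∉Φ = sym (∑-zero (λ k → χ-no (G ∈[ lo k , hi k ]?)
                                         (λ G∈Iₖ → G∉Φ (Equivalence.from (cover G) (k , G∈Iₖ)))))

  intervalForm : ℕ → ℤ → ℤ → ℤ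
  intervalForm N a b = ∑[ k < θ ] (a ^ base k * (a + b) ^ span k * b ^ (N ∸ span k ∸ base k))

  form-fvec-intervalForm : Unique Φ → ∀ a b → form m (λ l → + fvec Φ l) a b ≡ intervalForm m a b
  form-fvec-intervalForm Φ-uniq a b = begin
    form m (λ l → + fvec Φ l) a b
      ≡⟨ form-fvec Φ a b ⟩
    ∑ₗ Φ (weight a b)
      ≡⟨ ∑ₗ-as-∑ₛ Φ Φ-uniq (weight a b) ⟩
    ∑ₛ m (λ G → χ (G ∈ₗ? Φ) * weight a b G)
      ≡⟨ ∑ₛ-cong m (λ G → trans (cong (_* weight a b G) (χ-∈-as-∑ G))
                                (trans (ℤP.*-comm (∑[ k < θ ] χ (G ∈[ lo k , hi k ]?)) (weight a b G))
                                       (*-distribˡ-sum (weight a b G) (λ k → χ (G ∈[ lo k , hi k ]?))))) ⟩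
    ∑ₛ m (λ G → ∑[ k < θ ] (weight a b G * χ (G ∈[ lo k , hi k ]?)))
      ≡⟨ ∑ₛ-∑ m (λ k G → weight a b G * χ (G ∈[ lo k , hi k ]?)) ⟩
    ∑[ k < θ ] ∑ₛ m (λ G → weight a b G * χ (G ∈[ lo k , hi k ]?))
      ≡⟨ sum-cong-≗ (λ k → trans (∑ₛ-cong m (λ G → ℤP.*-comm (weight a b G) _)) (∑ₛ-interval a b (lo k) (hi k) (lo⊆hi k))) ⟩
    ∑[ k < θ ] (a ^ base k * (a + b) ^ span k * b ^ (m ∸ ∣ hi k ∣))
      ≡⟨ sum-cong-≗ (λ k → cong (λ e → a ^ base k * (a + b) ^ span k * b ^ e)
                                (trans (cong (m ∸_) (sym (span+base≡∣hi∣ k))) (sym (ℕP.∸-+-assoc m (span k) (base k))))) ⟩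
    intervalForm m a b ∎

  intervalForm-degree : ∀ M N → (∀ k → span k ℕ+ base k ≤ M) → (∀ k → span k ℕ+ base k ≤ N) →
    ∀ a b → b ^ M * intervalForm N a b ≡ b ^ N * intervalForm M a b
  intervalForm-degree M N ≤M ≤N a b = begin
    b ^ M * intervalForm N a b
      ≡⟨ *-distribˡ-sum (b ^ M) (λ k → c k * b ^ (N ∸ span k ∸ base k)) ⟩
    ∑[ k < θ ] (b ^ M * (c k * b ^ (N ∸ span k ∸ base k)))
      ≡⟨ sum-cong-≗ (λ k → exchange k) ⟩
    ∑[ k < θ ] (b ^ N * (c k * b ^ (M ∸ span k ∸ base k)))
      ≡⟨ sym (*-distribˡ-sum (b ^ N) (λ k → c k * b ^ (M ∸ span k ∸ base k))) ⟩
    b ^ N * intervalForm M a b ∎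
    where
    c : Fin θ → ℤ
    c k = a ^ base k * (a + b) ^ span k
    shuffle : ∀ x y z → x * (y * z) ≡ y * (x * z)
    shuffle = solve-∀
    exchange : ∀ k → b ^ M * (c k * b ^ (N ∸ span k ∸ base k)) ≡ b ^ N * (c k * b ^ (M ∸ span k ∸ base k))
    exchange k = begin
      b ^ M * (c k * b ^ (N ∸ span k ∸ base k))       ≡⟨ shuffle (b ^ M) (c k) _ ⟩
      c k * (b ^ M * b ^ (N ∸ span k ∸ base k))       ≡⟨ cong (λ e → c k * (b ^ M * b ^ e)) (ℕP.∸-+-assoc N (span k) (base k)) ⟩
      c k * (b ^ M * b ^ (N ∸ (span k ℕ+ base k)))    ≡⟨ cong (c k *_) (^-+-∸-comm b M N (≤M k) (≤N k)) ⟩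
      c k * (b ^ N * b ^ (M ∸ (span k ℕ+ base k)))    ≡⟨ cong (λ e → c k * (b ^ N * b ^ e)) (sym (ℕP.∸-+-assoc M (span k) (base k))) ⟩
      c k * (b ^ N * b ^ (M ∸ span k ∸ base k))       ≡⟨ shuffle (c k) (b ^ N) _ ⟩
      b ^ N * (c k * b ^ (M ∸ span k ∸ base k))       ∎

  intervalForm-reflect : Unique Φ → IsDS Φ → ∀ {n} → (∀ k → span k ℕ+ base k ≤ n) → n % 2 ≡ size Φ % 2 →
    ∀ a b → b ≢ 0ℤ → intervalForm n (- (a + b)) b ≡ sgn n * intervalForm n a b
  intervalForm-reflect Φ-uniq ds {n} fits parity a b b≢0 =
    ℤP.*-cancelˡ-≡ (b ^ m) _ _ {{ℤ.≢-nonZero (λ b^m≡0 → b≢0 (ℤP.i^n≡0⇒i≡0 b m b^m≡0))}} (begin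
      b ^ m * intervalForm n (- (a + b)) b    ≡⟨ intervalForm-degree m n span+base≤m fits (- (a + b)) b ⟩
      b ^ n * intervalForm m (- (a + b)) b    ≡⟨ cong (b ^ n *_) reflect-m ⟩
      b ^ n * (σ * intervalForm m a b)        ≡⟨ shuffle (b ^ n) σ _ ⟩
      σ * (b ^ n * intervalForm m a b)        ≡⟨ cong (σ *_) (sym (intervalForm-degree m n span+base≤m fits a b)) ⟩
      σ * (b ^ m * intervalForm n a b)        ≡⟨ shuffle σ (b ^ m) _ ⟩
      b ^ m * (σ * intervalForm n a b)        ≡⟨ cong (λ s → b ^ m * (s * intervalForm n a b)) (sgn-cong-%2 (size Φ) n (sym parity)) ⟩
      b ^ m * (sgn n * intervalForm n a b)    ∎)
    where
    σ : ℤ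
    σ = sgn (size Φ)
    F : ℤ → ℤ → ℤ
    F = form m (λ l → + fvec Φ l)
    shuffle : ∀ x y z → x * (y * z) ≡ y * (x * z)
    shuffle = solve-∀
    cancel : ∀ a b → - (- (a + b) + b) ≡ a
    cancel = solve-∀
    reflect-m : intervalForm m (- (a + b)) b ≡ σ * intervalForm m a b
    reflect-m = begin
      intervalForm m (- (a + b)) b  ≡⟨ sym (form-fvec-intervalForm Φ-uniq (- (a + b)) b) ⟩
      F (- (a + b)) b               ≡⟨ form-fvec-reflect Φ ds (- (a + b)) b ⟩
      σ * F (- (- (a + b) + b)) b   ≡⟨ cong (λ x → σ * F x b) (cancel a b) ⟩
      σ * F a b                     ≡⟨ cong (σ *_) (form-fvec-intervalForm Φ-uniq a b) ⟩
      σ * intervalForm m a b        ∎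

module _ {m} {Φ : FaceSystem m} (P : IntervalPartition Φ) (n : ℕ) where

  ρ ρ⁻ γ γᵀ : ℕ → ℤ
  ρ  l = psum P (λ i j → binom i (+ l - + j))
  ρ⁻ l = psum P (λ i j → sgn (i ℕ+ j) * binom j (+ l - + i))
  γ  l = psum P (λ i j → sgn j * binom (n ∸ i ∸ j) (+ l - + j))
  γᵀ l = psum P (λ i j → sgn j * binom (n ∸ i ∸ j) (+ l - + i))

module _ {m} {Φ : FaceSystem m} (P : IntervalPartition Φ) {n} (fits : ∀ k → span P k ℕ+ base P k ≤ n) where
  open IntervalPartition P using (θ)

  private
    s t r : Fin θ → ℕ
    s = span P
    t = base P
    r k = n ∸ s k ∸ t k

    s+t+r≡n : ∀ k → s k ℕ+ t k ℕ+ r k ≡ n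
    s+t+r≡n k = trans (cong (s k ℕ+ t k ℕ+_) (ℕP.∸-+-assoc n (s k) (t k))) (ℕP.m+[n∸m]≡n (fits k))

    t+s+r≡n : ∀ k → t k ℕ+ s k ℕ+ r k ≡ n
    t+s+r≡n k = trans (cong (_ℕ+ r k) (ℕP.+-comm (t k) (s k))) (s+t+r≡n k)

    t+r+s≡n : ∀ k → t k ℕ+ r k ℕ+ s k ≡ n
    t+r+s≡n k = trans (ℕP.+-comm (t k ℕ+ r k) (s k)) (trans (sym (ℕP.+-assoc (s k) (t k) (r k))) (s+t+r≡n k))

    s+r+t≡n : ∀ k → s k ℕ+ r k ℕ+ t k ≡ n
    s+r+t≡n k = trans (ℕP.+-assoc (s k) (r k) (t k))
      (trans (cong (s k ℕ+_) (ℕP.+-comm (r k) (t k))) (trans (sym (ℕP.+-assoc (s k) (t k) (r k))) (s+t+r≡n k)))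

  form-ρ : ∀ a b → form n (ρ P n) a b ≡ intervalForm P n a b
  form-ρ a b = trans (form-psum P n (λ l i j → binom i (+ l - + j)) a b)
    (sum-cong-≗ (λ k → form-binomial-shift (t k) (s k) (r k) (t+s+r≡n k) a b))

  form-ρ⁻ : ∀ a b → form n (ρ⁻ P n) a b ≡ intervalForm P n (- (a + b)) b
  form-ρ⁻ a b = trans (form-psum P n (λ l i j → sgn (i ℕ+ j) * binom j (+ l - + i)) a b)
    (sum-cong-≗ (λ k → begin
      form n (λ l → sgn (s k ℕ+ t k) * binom (t k) (+ l - + s k)) a b
        ≡⟨ sym (*-distribˡ-form n (sgn (s k ℕ+ t k)) _ a b) ⟩
      sgn (s k ℕ+ t k) * form n (λ l → binom (t k) (+ l - + s k)) a b
        ≡⟨ cong (sgn (s k ℕ+ t k) *_) (form-binomial-shift (s k) (t k) (r k) (s+t+r≡n k) a b) ⟩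
      sgn (s k ℕ+ t k) * (a ^ s k * (a + b) ^ t k * b ^ r k)
        ≡⟨ cong (_* (a ^ s k * (a + b) ^ t k * b ^ r k)) (sgn-+ (s k) (t k)) ⟩
      sgn (s k) * sgn (t k) * (a ^ s k * (a + b) ^ t k * b ^ r k)
        ≡⟨ shuffle (sgn (s k)) (sgn (t k)) (a ^ s k) ((a + b) ^ t k) (b ^ r k) ⟩
      sgn (t k) * (a + b) ^ t k * (sgn (s k) * a ^ s k) * b ^ r k
        ≡⟨ cong₂ (λ u v → u * v * b ^ r k) (sym (neg-^ (a + b) (t k)))
                 (trans (sym (neg-^ a (s k))) (cong (_^ s k) (sym (cancel a b)))) ⟩
      (- (a + b)) ^ t k * (- (a + b) + b) ^ s k * b ^ r k ∎))
    where
    shuffle : ∀ σ τ x y z → σ * τ * (x * y * z) ≡ τ * y * (σ * x) * z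
    shuffle = solve-∀
    cancel : ∀ a b → - (a + b) + b ≡ - a
    cancel = solve-∀

  form-γ : ∀ a b → form n (γ P n) a b ≡ intervalForm P n (- a) (a + b)
  form-γ a b = trans (form-psum P n (λ l i j → sgn j * binom (n ∸ i ∸ j) (+ l - + j)) a b)
    (sum-cong-≗ (λ k → begin
      form n (λ l → sgn (t k) * binom (r k) (+ l - + t k)) a b
        ≡⟨ sym (*-distribˡ-form n (sgn (t k)) _ a b) ⟩
      sgn (t k) * form n (λ l → binom (r k) (+ l - + t k)) a b
        ≡⟨ cong (sgn (t k) *_) (form-binomial-shift (t k) (r k) (s k) (t+r+s≡n k) a b) ⟩
      sgn (t k) * (a ^ t k * (a + b) ^ r k * b ^ s k)
        ≡⟨ shuffle (sgn (t k)) (a ^ t k) ((a + b) ^ r k) (b ^ s k) ⟩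
      sgn (t k) * a ^ t k * b ^ s k * (a + b) ^ r k
        ≡⟨ cong₂ (λ u v → u * v ^ s k * (a + b) ^ r k) (sym (neg-^ a (t k))) (sym (cancel a b)) ⟩
      (- a) ^ t k * (- a + (a + b)) ^ s k * (a + b) ^ r k ∎))
    where
    shuffle : ∀ σ x y z → σ * (x * y * z) ≡ σ * x * z * y
    shuffle = solve-∀
    cancel : ∀ a b → - a + (a + b) ≡ b
    cancel = solve-∀

  form-γᵀ : ∀ a b → form n (γᵀ P n) a b ≡ form n (γ P n) b a
  form-γᵀ a b = begin
    form n (γᵀ P n) a b
      ≡⟨ form-psum P n (λ l i j → sgn j * binom (n ∸ i ∸ j) (+ l - + i)) a b ⟩
    ∑[ k < θ ] form n (λ l → sgn (t k) * binom (r k) (+ l - + s k)) a b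
      ≡⟨ sum-cong-≗ (λ k → begin
           form n (λ l → sgn (t k) * binom (r k) (+ l - + s k)) a b
             ≡⟨ sym (*-distribˡ-form n (sgn (t k)) _ a b) ⟩
           sgn (t k) * form n (λ l → binom (r k) (+ l - + s k)) a b
             ≡⟨ cong (sgn (t k) *_) (form-binomial-shift (s k) (r k) (t k) (s+r+t≡n k) a b) ⟩
           sgn (t k) * (a ^ s k * (a + b) ^ r k * b ^ t k)
             ≡⟨ cong (sgn (t k) *_) (shuffle (a ^ s k) ((a + b) ^ r k) (b ^ t k)) ⟩
           sgn (t k) * (b ^ t k * (a + b) ^ r k * a ^ s k)
             ≡⟨ cong (λ x → sgn (t k) * (b ^ t k * x ^ r k * a ^ s k)) (ℤP.+-comm a b) ⟩
           sgn (t k) * (b ^ t k * (b + a) ^ r k * a ^ s k)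
             ≡⟨ cong (sgn (t k) *_) (sym (form-binomial-shift (t k) (r k) (s k) (t+r+s≡n k) b a)) ⟩
           sgn (t k) * form n (λ l → binom (r k) (+ l - + t k)) b a
             ≡⟨ *-distribˡ-form n (sgn (t k)) _ b a ⟩
           form n (λ l → sgn (t k) * binom (r k) (+ l - + t k)) b a ∎) ⟩
    ∑[ k < θ ] form n (λ l → sgn (t k) * binom (r k) (+ l - + t k)) b a
      ≡⟨ sym (form-psum P n (λ l i j → sgn j * binom (n ∸ i ∸ j) (+ l - + j)) b a) ⟩
    form n (γ P n) b a ∎
    where
    shuffle : ∀ x y z → x * y * z ≡ z * y * x
    shuffle = solve-∀

module _ {m} {Φ : FaceSystem m} (Φ-uniq : Unique Φ) (ds : IsDS Φ) (P : IntervalPartition Φ)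
         {n} (η≤n : η Φ ≤ n) (parity : n % 2 ≡ size Φ % 2) where

  private
    fits : ∀ k → span P k ℕ+ base P k ≤ n
    fits k = ℕP.≤-trans (span+base≤η P k) η≤n

    reflect : ∀ a b → b ≢ 0ℤ → intervalForm P n (- (a + b)) b ≡ sgn n * intervalForm P n a b
    reflect = intervalForm-reflect P Φ-uniq ds fits parity

  ρ⁻≡±ρ : ∀ l → l ≤ n → ρ⁻ P n l ≡ sgn n * ρ P n l
  ρ⁻≡±ρ = form-injective n (ρ⁻ P n) (λ l → sgn n * ρ P n l) (λ t → begin
    form n (ρ⁻ P n) (+ suc t) 1ℤ                  ≡⟨ form-ρ⁻ P fits (+ suc t) 1ℤ ⟩
    intervalForm P n (- (+ suc t + 1ℤ)) 1ℤ        ≡⟨ reflect (+ suc t) 1ℤ (λ ()) ⟩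
    sgn n * intervalForm P n (+ suc t) 1ℤ         ≡⟨ cong (sgn n *_) (sym (form-ρ P fits (+ suc t) 1ℤ)) ⟩
    sgn n * form n (ρ P n) (+ suc t) 1ℤ           ≡⟨ *-distribˡ-form n (sgn n) (ρ P n) (+ suc t) 1ℤ ⟩
    form n (λ l → sgn n * ρ P n l) (+ suc t) 1ℤ   ∎)

  form-γ-swap : ∀ a b → a + b ≢ 0ℤ → form n (γ P n) b a ≡ sgn n * form n (γ P n) a b
  form-γ-swap a b a+b≢0 = begin
    form n (γ P n) b a                            ≡⟨ form-γ P fits b a ⟩
    intervalForm P n (- b) (b + a)                ≡⟨ cong₂ (intervalForm P n) (sym (cancel a b)) (ℤP.+-comm b a) ⟩
    intervalForm P n (- (- a + (a + b))) (a + b)  ≡⟨ reflect (- a) (a + b) a+b≢0 ⟩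
    sgn n * intervalForm P n (- a) (a + b)        ≡⟨ cong (sgn n *_) (sym (form-γ P fits a b)) ⟩
    sgn n * form n (γ P n) a b                    ∎
    where
    cancel : ∀ a b → - (- a + (a + b)) ≡ - b
    cancel = solve-∀

  γᵀ≡±γ : ∀ l → l ≤ n → γᵀ P n l ≡ sgn n * γ P n l
  γᵀ≡±γ = form-injective n (γᵀ P n) (λ l → sgn n * γ P n l) (λ t → begin
    form n (γᵀ P n) (+ suc t) 1ℤ                  ≡⟨ form-γᵀ P fits (+ suc t) 1ℤ ⟩
    form n (γ P n) 1ℤ (+ suc t)                   ≡⟨ form-γ-swap (+ suc t) 1ℤ (λ ()) ⟩
    sgn n * form n (γ P n) (+ suc t) 1ℤ           ≡⟨ *-distribˡ-form n (sgn n) (γ P n) (+ suc t) 1ℤ ⟩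
    form n (λ l → sgn n * γ P n l) (+ suc t) 1ℤ   ∎)

  γ-palindromic : ∀ s → s ≤ n → γ P n (n ∸ s) ≡ sgn n * γ P n s
  γ-palindromic = form-injective n (λ s → γ P n (n ∸ s)) (λ s → sgn n * γ P n s) (λ t → begin
    form n (λ s → γ P n (n ∸ s)) (+ suc t) 1ℤ     ≡⟨ form-reverse n (γ P n) (+ suc t) 1ℤ ⟩
    form n (γ P n) 1ℤ (+ suc t)                   ≡⟨ form-γ-swap (+ suc t) 1ℤ (λ ()) ⟩
    sgn n * form n (γ P n) (+ suc t) 1ℤ           ≡⟨ *-distribˡ-form n (sgn n) (γ P n) (+ suc t) 1ℤ ⟩
    form n (λ s → sgn n * γ P n s) (+ suc t) 1ℤ   ∎)

  ∑binom-γ-reverse : ∀ l → sumTo n (λ s → binom s (+ l) * γ P n s)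
                         ≡ sgn n * sumTo n (λ s → binom (n ∸ s) (+ l) * γ P n s)
  ∑binom-γ-reverse l = sym (begin
    sgn n * sumTo n (λ s → binom (n ∸ s) (+ l) * γ P n s)
      ≡⟨ cong (sgn n *_) (sym (sumTo-reverse n (λ s → binom (n ∸ s) (+ l) * γ P n s))) ⟩
    sgn n * sumTo n (λ s → binom (n ∸ (n ∸ s)) (+ l) * γ P n (n ∸ s))
      ≡⟨ cong (sgn n *_) (sumTo-cong n (λ s s≤n →
           cong₂ (λ e x → binom e (+ l) * x) (ℕP.m∸[m∸n]≡n s≤n) (γ-palindromic s s≤n))) ⟩
    sgn n * sumTo n (λ s → binom s (+ l) * (sgn n * γ P n s))
      ≡⟨ *-distribˡ-sumTo n (sgn n) _ ⟩
    sumTo n (λ s → sgn n * (binom s (+ l) * (sgn n * γ P n s)))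
      ≡⟨ sumTo-cong n (λ s _ → cancel-signs (sgn n) (binom s (+ l)) (γ P n s) (sgn-*-sgn n)) ⟩
    sumTo n (λ s → binom s (+ l) * γ P n s) ∎)
    where
    cancel-signs : ∀ σ x y → σ * σ ≡ 1ℤ → σ * (x * (σ * y)) ≡ x * y
    cancel-signs σ x y σ²≡1 = begin
      σ * (x * (σ * y))  ≡⟨ shuffle σ x y ⟩
      σ * σ * (x * y)    ≡⟨ cong (_* (x * y)) σ²≡1 ⟩
      1ℤ * (x * y)       ≡⟨ ℤP.*-identityˡ (x * y) ⟩
      x * y              ∎
      where
      shuffle : ∀ σ x y → σ * (x * (σ * y)) ≡ σ * σ * (x * y)
      shuffle = solve-∀

mainTheorem10 : (m : ℕ) → 0 < m → (Φ : FaceSystem m) → Unique Φ → IsDS Φ → 0 < card Φ →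
    (n : ℕ) → 0 < n → η Φ ≤ n → n % 2 ≡ size Φ % 2 →
    (P : IntervalPartition Φ) → (l : ℕ) → l ≤ n →
    (psum P (λ i j → sgn (i ℕ+ j) * binom j (+ l - + i))
       ≡ sgn n * psum P (λ i j → binom i (+ l - + j)))
    × (psum P (λ i j → sgn j * binom (n ∸ i ∸ j) (+ l - + i))
       ≡ sgn n * psum P (λ i j → sgn j * binom (n ∸ i ∸ j) (+ l - + j)))
    × (sumTo n (λ s → binom s (+ l) * psum P (λ i j → sgn j * binom (n ∸ i ∸ j) (+ s - + j)))
       ≡ sgn n * sumTo n (λ s → binom (n ∸ s) (+ l) * psum P (λ i j → sgn j * binom (n ∸ i ∸ j) (+ s - + j))))
mainTheorem10 m _ Φ Φ-uniq ds _ n _ η≤n parity P l l≤n =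
    ρ⁻≡±ρ Φ-uniq ds P η≤n parity l l≤n
  , γᵀ≡±γ Φ-uniq ds P η≤n parity l l≤n
  , ∑binom-γ-reverse Φ-uniq ds P η≤n parity l
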